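{- For integers $m\ge1$, $n\ge0$, $k\ge0$, $$S(m,n,k)=h_{n-k}(1,m+1,2m+1,\dots,km+1)$$ and $$\overline S(m,n,k)=h_{n-k}(1,m+1,2m+1,\dots,km+1)-n\,h_{n-k-1}(m,2m,\dots,km).$$
   Context: $h_j(y_1,\dots,y_r)$ is the complete homogeneous symmetric polynomial of degree $j$ (the sum of all monomials of degree $j$), with $h_0=1$ and $h_j=0$ for $j<0$ (and $h_j$ of no variables equal to $\delta_{j,0}$). Let $\zeta_m=e^{2\pi i/m}$, $\mathbf e_1,\dots,\mathbf e_n$ the standard basis of $\mathbb C^n$, $i^c=\zeta_m^c\mathbf e_i$ for $i\in[n]$ (colors mod $m$), and $[n^m]=\{0\}\cup\{i^c:i\in[n],0\le c<m\}$. For a scalar $z$ and $S\subseteq[n^m]$, $zS=\{zs:s\in S\}$. A colored set partition of type $(m,n)$ is a set partition of $[n^m]$ into blocks $S_0,S_1,\dots,S_{km}$ such that (i) $0\in S_0$, and if $i^c\in S_0$ for some $c$ then $i^d\in S_0$ for all $d$; (ii) for each $0\le l<k$ the blocks $S_{lm+1},\dots,S_{(l+1)m}$ are distinct and equal to $S,\zeta_mS,\dots,\zeta_m^{m-1}S$ for some $S$. $S(m,n,k)$ is the number of such partitions with $km+1$ blocks; $\overline S(m,n,k)$ is the number of those whose zero block $S_0$ is not of the form $\{0,i^0,i^1,\dots,i^{m-1}\}$ for any $i\in[n]$. -}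

module Defs where

open import Data.Bool using (Bool; true; false; _∧_; _∨_; not; if_then_else_)
import Data.Bool.Properties as BoolP
open import Data.Nat using (ℕ; zero; suc; _+_; _*_; _^_; NonZero; _<ᵇ_; _∸_; _≡ᵇ_)
open import Data.Nat.DivMod using (_mod_)
open import Data.Fin using (Fin; toℕ; combine; remQuot) renaming (zero to fz; suc to fs)
import Data.Fin.Properties as FinP
open import Data.Fin.Subset using (Subset)
open import Data.Product using (_,_; proj₁; proj₂)
open import Data.List using (List; []; _∷_; map; concatMap; length; filterᵇ; deduplicateᵇ; allFin; upTo)
open import Data.Bool.ListAction using (all; any)
open import Data.Nat.ListAction using (sum)
open import Data.Vec using (Vec; []; _∷_; lookup; tabulate; toList)
import Data.Vec.Properties as VecP
open import Relation.Nullary.Decidable using (isYes)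

allVecs : {A : Set} → List A → (r : ℕ) → List (Vec A r)
allVecs xs zero    = [] ∷ []
allVecs xs (suc r) = concatMap (λ x → map (x ∷_) (allVecs xs r)) xs

vsum : {r : ℕ} → Vec ℕ r → ℕ
vsum []       = 0
vsum (x ∷ xs) = x + vsum xs

monomial : {r : ℕ} → Vec ℕ r → Vec ℕ r → ℕ
monomial []       []       = 1
monomial (y ∷ ys) (e ∷ es) = y ^ e * monomial ys es

-- h j ys  (each exponent of a degree-j monomial is ≤ j)
h : ℕ → {r : ℕ} → Vec ℕ r → ℕ
h j {r} ys = sum (map (monomial ys) (filterᵇ (λ e → vsum e ≡ᵇ j) (allVecs (upTo (suc j)) r)))

-- h_{a-b} for a possibly negative index a - b (h of negative degree is 0)
hsub : ℕ → ℕ → {r : ℕ} → Vec ℕ r → ℕ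
hsub a b ys = if a <ᵇ b then 0 else h (a ∸ b) ys

vars1 : (m k : ℕ) → Vec ℕ (suc k)
vars1 m k = tabulate (λ i → toℕ i * m + 1)

vars2 : (m k : ℕ) → Vec ℕ k
vars2 m k = tabulate (λ i → suc (toℕ i) * m)

-- The ground set [n^m] = {0} ∪ {i^c}, encoded as Fin (1 + n*m):
-- 0 ↦ fz,  i^c ↦ fs (combine i c).

Pt : ℕ → ℕ → Set
Pt n m = Fin (suc (n * m))

col : (n m : ℕ) → Fin n → Fin m → Pt n m
col n m i c = fs (combine i c)

-- multiplication by ζ_m^j :  0 ↦ 0,  i^c ↦ i^{c+j mod m}
rot : (n m : ℕ) → .{{_ : NonZero m}} → ℕ → Pt n m → Pt n m
rot n m j fz     = fz
rot n m j (fs x) = col n m (proj₁ (remQuot {n} m x)) ((toℕ (proj₂ (remQuot {n} m x)) + j) mod m)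

eqFin : {N : ℕ} → Fin N → Fin N → Bool
eqFin x y = isYes (x FinP.≟ y)

eqSub : {N : ℕ} → Subset N → Subset N → Bool
eqSub S T = isYes (VecP.≡-dec BoolP._≟_ S T)

allF : (N : ℕ) → (Fin N → Bool) → Bool
allF N p = all p (allFin N)

anyF : (N : ℕ) → (Fin N → Bool) → Bool
anyF N p = any p (allFin N)

rotSet : (n m : ℕ) → .{{_ : NonZero m}} → ℕ → Subset (suc (n * m)) → Subset (suc (n * m))
rotSet n m j S = tabulate (λ y → anyF (suc (n * m)) (λ s → lookup S s ∧ eqFin (rot n m j s) y))

-- A set partition of a finite set Fin N is encoded by the map B sending
-- each point x to the block B x containing x.  Such a B comes from a set
-- partition iff x ∈ B x and (y ∈ B x ⇒ B y = B x); this is a bijection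
-- between set partitions of Fin N and such maps.

Part : ℕ → Set
Part N = Vec (Subset N) N

isSetPartition : {N : ℕ} → Part N → Bool
isSetPartition {N} B =
  allF N (λ x → lookup (lookup B x) x ∧
    allF N (λ y → not (lookup (lookup B x) y) ∨ eqSub (lookup B y) (lookup B x)))

blocks : {N : ℕ} → Part N → List (Subset N)
blocks B = deduplicateᵇ eqSub (toList B)

isBlock : {N : ℕ} → Part N → Subset N → Bool
isBlock B S = any (eqSub S) (blocks B)

numBlocks : {N : ℕ} → Part N → ℕ
numBlocks B = length (blocks B)

zeroBlock : (n m : ℕ) → Part (suc (n * m)) → Subset (suc (n * m))
zeroBlock n m B = lookup B fz

condI : (n m : ℕ) → Part (suc (n * m)) → Bool
condI n m B = allF n (λ i → allF m (λ c →
  not (lookup (zeroBlock n m B) (col n m i c)) ∨ allF m (λ d → lookup (zeroBlock n m B) (col n m i d))))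

condII : (n m : ℕ) → .{{_ : NonZero m}} → Part (suc (n * m)) → Bool
condII n m B = all (λ S → eqSub S (zeroBlock n m B) ∨
    (allF m (λ a → isBlock B (rotSet n m (toℕ a) S)) ∧
     allF m (λ a → allF m (λ b →
       not (eqSub (rotSet n m (toℕ a) S) (rotSet n m (toℕ b) S)) ∨ eqFin a b))))
  (blocks B)

isColoredPartition : (m n k : ℕ) → .{{_ : NonZero m}} → Part (suc (n * m)) → Bool
isColoredPartition m n k B =
  isSetPartition B ∧ condI n m B ∧ condII n m B ∧ (numBlocks B ≡ᵇ k * m + 1)

isSpecialZero : (n m : ℕ) → Part (suc (n * m)) → Bool
isSpecialZero n m B = anyF n (λ i →
  eqSub (zeroBlock n m B)
        (tabulate (λ y → eqFin y fz ∨ anyF m (λ d → eqFin y (col n m i d)))))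

allParts : (N : ℕ) → List (Part N)
allParts N = allVecs (allVecs (true ∷ false ∷ []) N) N

Scol : (m n k : ℕ) → .{{_ : NonZero m}} → ℕ
Scol m n k = length (filterᵇ (isColoredPartition m n k) (allParts (suc (n * m))))

Sbar : (m n k : ℕ) → .{{_ : NonZero m}} → ℕ
Sbar m n k = length (filterᵇ (λ B → isColoredPartition m n k B ∧ not (isSpecialZero n m B))
                             (allParts (suc (n * m))))

-- Deleting the point n + 1, with all its colours, from a coloured set partition of [(n+1)^m] with km + 1
-- blocks leaves a coloured set partition of [n^m] together with the set S of old points in the block of
-- (n+1)^0, and the partition is recovered from this pair.  Either (n+1)^0 lies in the zero block (S is
-- the zero block), or its orbit consists of m new singleton blocks (S = ∅, and one orbit fewer is left),
-- or it joins one of the km non-zero blocks.  Hence S(m,n+1,k) = (km+1) S(m,n,k) + S(m,n,k-1), which is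
-- the recurrence of h_{n-k}(1, m+1, ..., km+1) under adding the variable km+1.  Counting only partitions
-- whose zero block is {0} drops the first case and gives h_{n-k}(m, ..., km).  A zero block
-- {0, i^0, ..., i^(m-1)} is either that of the new point, over a trivial zero block, or inherited from
-- the restriction; this gives n h_{n-k-1}(m, ..., km) partitions excluded from the count of S̄.

module Submission where

open import Defs
open import Data.Bool using (Bool; true; false; _∧_; _∨_; not; T; if_then_else_)
import Data.Bool.Properties as Bool
open import Data.Bool.Properties using (T-≡; ∨-identityʳ; ∨-zeroʳ; ∨-inverseʳ; ∧-identityʳ; ∧-zeroʳ; not-involutive)
open import Data.Bool.ListAction using (all; any; or)
open import Data.Nat
open import Data.Nat.Properties
open import Data.Nat.DivMod using (_mod_; m%n<n; %-distribˡ-+; m%n%n≡m%n; m<n⇒m%n≡m; n%n≡0)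
open import Data.Nat.ListAction using (sum)
open import Data.Nat.ListAction.Properties using (sum-++)
open import Data.Nat.Solver using (module +-*-Solver)
open import Data.List using (List; []; _∷_; map; concatMap; filter; filterᵇ; length; _++_; upTo; applyUpTo; allFin; cartesianProductWith; cartesianProduct; deduplicate; deduplicateᵇ)
import Data.List.Properties as List
open import Data.List.Membership.Propositional using (_∈_)
import Data.List.Membership.Propositional.Properties as ∈
open import Data.List.Membership.Propositional.Properties.WithK using (unique∧set⇒bag)
open import Data.List.Relation.Unary.Any using (here; there)
import Data.List.Relation.Unary.All as All
open import Data.List.Relation.Unary.All using ([]; _∷_)
open import Data.List.Relation.Unary.AllPairs using ([]; _∷_)
open import Data.List.Relation.Unary.Unique.Propositional using (Unique)
import Data.List.Relation.Unary.Unique.Propositional.Properties as Unique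
open import Data.List.Relation.Binary.BagAndSetEquality using (∼bag⇒↭)
open import Data.List.Relation.Binary.Permutation.Propositional.Properties using (↭-length)
open import Data.Vec using (Vec; []; _∷_; lookup; tabulate; toList; _∷ʳ_)
import Data.Vec.Properties as Vec
import Data.Vec.Membership.Propositional.Properties as Vec∈
import Data.Vec.Relation.Unary.Any as VecAny
import Data.Vec.Relation.Unary.Any.Properties as VecAny
open import Data.Fin using (Fin; toℕ; inject₁; fromℕ; _↑ˡ_; _↑ʳ_; splitAt) renaming (zero to fzero; suc to fsuc)
import Data.Fin.Properties as Fin
open import Data.Fin.Subset using (Subset) renaming (⊥ to ∅)
open import Data.Product using (_×_; _,_; proj₁; proj₂; ∃)
open import Data.Sum using (_⊎_; inj₁; inj₂; [_,_]′)
open import Data.Sum.Properties using (inj₁-injective)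
open import Data.Empty using (⊥; ⊥-elim)
open import Function using (_∘_; id; _⇔_; mk⇔; Equivalence)
open import Relation.Binary.Definitions using (DecidableEquality)
open import Relation.Nullary using (¬_; ¬?; Dec; yes; no; contradiction)
open import Relation.Nullary.Decidable using (isYes; T?; toWitness; fromWitness)
open import Relation.Binary.PropositionalEquality

private variable
  A B : Set
  r K : ℕ


-- Complete homogeneous polynomials

sum-map-filterᵇ : ∀ (f : A → ℕ) p xs →
  sum (map f (filterᵇ p xs)) ≡ sum (map (λ x → if p x then f x else 0) xs)
sum-map-filterᵇ f p []       = refl
sum-map-filterᵇ f p (x ∷ xs) with p x
... | true  = cong (f x +_) (sum-map-filterᵇ f p xs)
... | false = sum-map-filterᵇ f p xs

sum-concatMap : ∀ (f : A → List ℕ) xs → sum (concatMap f xs) ≡ sum (map (sum ∘ f) xs)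
sum-concatMap f []       = refl
sum-concatMap f (x ∷ xs) = trans (sum-++ (f x) _) (cong (sum (f x) +_) (sum-concatMap f xs))

sum-map-*ˡ : ∀ c (f : A → ℕ) xs → sum (map (λ x → c * f x) xs) ≡ c * sum (map f xs)
sum-map-*ˡ c f []       = sym (*-zeroʳ c)
sum-map-*ˡ c f (x ∷ xs) = trans (cong (c * f x +_) (sum-map-*ˡ c f xs)) (sym (*-distribˡ-+ c (f x) _))

sum-map-zero : ∀ (f : A → ℕ) xs → (∀ x → f x ≡ 0) → sum (map f xs) ≡ 0
sum-map-zero f []       f≡0 = refl
sum-map-zero f (x ∷ xs) f≡0 rewrite f≡0 x = sum-map-zero f xs f≡0

sum-applyUpTo-cong : ∀ (f g : ℕ → ℕ) n → (∀ {e} → e < n → f e ≡ g e) →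
  sum (applyUpTo f n) ≡ sum (applyUpTo g n)
sum-applyUpTo-cong f g zero    f≡g = refl
sum-applyUpTo-cong f g (suc n) f≡g =
  cong₂ _+_ (f≡g z<s) (sum-applyUpTo-cong (f ∘ suc) (g ∘ suc) n (f≡g ∘ s<s))

sum-applyUpTo-truncate : ∀ (f : ℕ → ℕ) {n b} → n ≤ b → (∀ {e} → n ≤ e → f e ≡ 0) →
  sum (applyUpTo f b) ≡ sum (applyUpTo f n)
sum-applyUpTo-truncate f {zero}  {zero}  _         f≡0 = refl
sum-applyUpTo-truncate f {zero}  {suc b} _         f≡0 =
  cong₂ _+_ (f≡0 z≤n) (sum-applyUpTo-truncate (f ∘ suc) {zero} {b} z≤n (λ _ → f≡0 z≤n))
sum-applyUpTo-truncate f {suc n} {suc b} (s≤s n≤b) f≡0 =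
  cong (f 0 +_) (sum-applyUpTo-truncate (f ∘ suc) n≤b (f≡0 ∘ s≤s))

sum-applyUpTo-*ˡ : ∀ c (f : ℕ → ℕ) n → sum (applyUpTo (λ e → c * f e) n) ≡ c * sum (applyUpTo f n)
sum-applyUpTo-*ˡ c f zero    = sym (*-zeroʳ c)
sum-applyUpTo-*ˡ c f (suc n) =
  trans (cong (c * f 0 +_) (sum-applyUpTo-*ˡ c (f ∘ suc) n)) (sym (*-distribˡ-+ c (f 0) _))

-- Coefficients of g(t) / (1 − y t).
geometricTimes : ℕ → (ℕ → ℕ) → ℕ → ℕ
geometricTimes y g zero    = g zero
geometricTimes y g (suc j) = g (suc j) + y * geometricTimes y g j

geometricTimes-sum : ∀ y g j → geometricTimes y g j ≡ sum (applyUpTo (λ e → y ^ e * g (j ∸ e)) (suc j))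
geometricTimes-sum y g zero    = sym (trans (+-identityʳ _) (*-identityˡ (g 0)))
geometricTimes-sum y g (suc j) = begin
  g (suc j) + y * geometricTimes y g j
    ≡⟨ cong₂ _+_ (sym (*-identityˡ (g (suc j)))) (cong (y *_) (geometricTimes-sum y g j)) ⟩
  1 * g (suc j) + y * sum (applyUpTo (λ e → y ^ e * g (j ∸ e)) (suc j))
    ≡⟨ cong (1 * g (suc j) +_) (sym (sum-applyUpTo-*ˡ y (λ e → y ^ e * g (j ∸ e)) (suc j))) ⟩
  1 * g (suc j) + sum (applyUpTo (λ e → y * (y ^ e * g (j ∸ e))) (suc j))
    ≡⟨ cong (1 * g (suc j) +_) (sum-applyUpTo-cong _ _ (suc j) (λ {e} _ → sym (*-assoc y (y ^ e) (g (j ∸ e))))) ⟩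
  1 * g (suc j) + sum (applyUpTo (λ e → y ^ suc e * g (j ∸ e)) (suc j)) ∎
  where open ≡-Reasoning

geometricTimes-cong : ∀ y {g g′} → (∀ i → g i ≡ g′ i) → ∀ j → geometricTimes y g j ≡ geometricTimes y g′ j
geometricTimes-cong y g≡g′ zero    = g≡g′ 0
geometricTimes-cong y g≡g′ (suc j) = cong₂ _+_ (g≡g′ (suc j)) (cong (y *_) (geometricTimes-cong y g≡g′ j))

geometricTimes-comm : ∀ y z g j → geometricTimes y (geometricTimes z g) j ≡ geometricTimes z (geometricTimes y g) j
geometricTimes-comm y z g zero          = refl
geometricTimes-comm y z g (suc zero)    = solve 4 (λ y z a b → (a :+ z :* b) :+ y :* b := (a :+ y :* b) :+ z :* b)
                                                  refl y z (g 1) (g 0)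
  where open +-*-Solver
geometricTimes-comm y z g (suc (suc j)) = begin
  (g (2 + j) + z * Z₁) + y * YZ₁
    ≡⟨ cong (λ t → (g (2 + j) + z * Z₁) + y * t) (geometricTimes-comm y z g (suc j)) ⟩
  (g (2 + j) + z * Z₁) + y * (Y₁ + z * ZY₀)
    ≡⟨ solve 6 (λ a y z z₁ y₁ w → (a :+ z :* z₁) :+ y :* (y₁ :+ z :* w) := (a :+ y :* y₁) :+ z :* (z₁ :+ y :* w))
             refl (g (2 + j)) y z Z₁ Y₁ ZY₀ ⟩
  (g (2 + j) + y * Y₁) + z * (Z₁ + y * ZY₀)
    ≡⟨ cong (λ t → (g (2 + j) + y * Y₁) + z * (Z₁ + y * t)) (sym (geometricTimes-comm y z g j)) ⟩
  (g (2 + j) + y * Y₁) + z * (Z₁ + y * geometricTimes y (geometricTimes z g) j)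
    ≡⟨ cong (λ t → (g (2 + j) + y * Y₁) + z * t) (geometricTimes-comm y z g (suc j)) ⟩
  (g (2 + j) + y * Y₁) + z * geometricTimes z (geometricTimes y g) (suc j) ∎
  where
  open ≡-Reasoning
  open +-*-Solver
  Z₁ Y₁ YZ₁ ZY₀ : ℕ
  Z₁  = geometricTimes z g (suc j)
  Y₁  = geometricTimes y g (suc j)
  YZ₁ = geometricTimes y (geometricTimes z g) (suc j)
  ZY₀ = geometricTimes z (geometricTimes y g) j

hRec : ℕ → Vec ℕ r → ℕ
hRec j       (y ∷ ys) = geometricTimes y (λ i → hRec i ys) j
hRec zero    []       = 1
hRec (suc j) []       = 0

hTerm : ℕ → Vec ℕ r → Vec ℕ r → ℕ
hTerm j ys e = if vsum e ≡ᵇ j then monomial ys e else 0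

-- The sum defining h with the exponent bound freed from the degree, so that it stays fixed in the induction.
hBounded : ℕ → ℕ → Vec ℕ r → ℕ
hBounded {r} b j ys = sum (map (hTerm j ys) (allVecs (upTo b) r))

+-≡ᵇ-∸ : ∀ e s j → e ≤ j → (e + s ≡ᵇ j) ≡ (s ≡ᵇ j ∸ e)
+-≡ᵇ-∸ zero    s j       _         = refl
+-≡ᵇ-∸ (suc e) s (suc j) (s≤s e≤j) = +-≡ᵇ-∸ e s j e≤j

+-≡ᵇ-> : ∀ e s j → j < e → (e + s ≡ᵇ j) ≡ false
+-≡ᵇ-> (suc e) s zero    _         = refl
+-≡ᵇ-> (suc e) s (suc j) (s≤s j<e) = +-≡ᵇ-> e s j j<e

hTerm-∷-≤ : ∀ j y (ys : Vec ℕ r) e es → e ≤ j → hTerm j (y ∷ ys) (e ∷ es) ≡ y ^ e * hTerm (j ∸ e) ys es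
hTerm-∷-≤ j y ys e es e≤j rewrite +-≡ᵇ-∸ e (vsum es) j e≤j with vsum es ≡ᵇ j ∸ e
... | true  = refl
... | false = sym (*-zeroʳ (y ^ e))

hTerm-∷-> : ∀ j y (ys : Vec ℕ r) e es → j < e → hTerm j (y ∷ ys) (e ∷ es) ≡ 0
hTerm-∷-> j y ys e es j<e rewrite +-≡ᵇ-> e (vsum es) j j<e = refl

hBounded-∷ : ∀ b j y (ys : Vec ℕ r) →
  hBounded b j (y ∷ ys) ≡ sum (applyUpTo (λ e → sum (map (hTerm j (y ∷ ys) ∘ (e ∷_)) (allVecs (upTo b) r))) b)
hBounded-∷ {r} b j y ys = begin
  sum (map (hTerm j (y ∷ ys)) (concatMap (λ e → map (e ∷_) V) (upTo b)))
    ≡⟨ cong sum (List.map-concatMap (hTerm j (y ∷ ys)) _ (upTo b)) ⟩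
  sum (concatMap (λ e → map (hTerm j (y ∷ ys)) (map (e ∷_) V)) (upTo b))
    ≡⟨ sum-concatMap _ (upTo b) ⟩
  sum (map (λ e → sum (map (hTerm j (y ∷ ys)) (map (e ∷_) V))) (upTo b))
    ≡⟨ cong sum (List.map-cong (λ e → cong sum (sym (List.map-∘ V))) (upTo b)) ⟩
  sum (map (λ e → sum (map (hTerm j (y ∷ ys) ∘ (e ∷_)) V)) (upTo b))
    ≡⟨ cong sum (List.map-applyUpTo (λ e → e) _ b) ⟩
  sum (applyUpTo (λ e → sum (map (hTerm j (y ∷ ys) ∘ (e ∷_)) V)) b) ∎
  where
  open ≡-Reasoning
  V : List (Vec ℕ r)
  V = allVecs (upTo b) r

hBounded≡hRec : ∀ b j (ys : Vec ℕ r) → j < b → hBounded b j ys ≡ hRec j ys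
hBounded≡hRec b zero    []       _   = refl
hBounded≡hRec b (suc j) []       _   = refl
hBounded≡hRec {suc r} b j (y ∷ ys) j<b = begin
  hBounded b j (y ∷ ys)                           ≡⟨ hBounded-∷ b j y ys ⟩
  sum (applyUpTo column b)                        ≡⟨ sum-applyUpTo-truncate column j<b column-vanishes ⟩
  sum (applyUpTo column (suc j))                  ≡⟨ sum-applyUpTo-cong _ _ (suc j) column≡ ⟩
  sum (applyUpTo (λ e → y ^ e * hRec (j ∸ e) ys) (suc j)) ≡⟨ geometricTimes-sum y (λ i → hRec i ys) j ⟨
  hRec j (y ∷ ys)                                 ∎
  where
  open ≡-Reasoning
  V : List (Vec ℕ r)
  V = allVecs (upTo b) r
  column : ℕ → ℕ
  column e = sum (map (hTerm j (y ∷ ys) ∘ (e ∷_)) V)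
  column-vanishes : ∀ {e} → j < e → column e ≡ 0
  column-vanishes {e} j<e = sum-map-zero _ V (λ es → hTerm-∷-> j y ys e es j<e)
  column≡ : ∀ {e} → e < suc j → column e ≡ y ^ e * hRec (j ∸ e) ys
  column≡ {e} (s≤s e≤j) = begin
    column e                                    ≡⟨ cong sum (List.map-cong (λ es → hTerm-∷-≤ j y ys e es e≤j) V) ⟩
    sum (map (λ es → y ^ e * hTerm (j ∸ e) ys es) V) ≡⟨ sum-map-*ˡ (y ^ e) _ V ⟩
    y ^ e * hBounded b (j ∸ e) ys
      ≡⟨ cong (y ^ e *_) (hBounded≡hRec b (j ∸ e) ys (≤-<-trans (m∸n≤m j e) j<b)) ⟩
    y ^ e * hRec (j ∸ e) ys                     ∎

h≡hRec : ∀ j (ys : Vec ℕ r) → h j ys ≡ hRec j ys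
h≡hRec {r} j ys = trans (sum-map-filterᵇ (monomial ys) _ (allVecs (upTo (suc j)) r)) (hBounded≡hRec (suc j) j ys ≤-refl)

hRec-∷ʳ : ∀ (ys : Vec ℕ r) z j → hRec j (ys ∷ʳ z) ≡ hRec j (z ∷ ys)
hRec-∷ʳ []       z j = refl
hRec-∷ʳ (y ∷ ys) z j =
  trans (geometricTimes-cong y (hRec-∷ʳ ys z) j) (geometricTimes-comm y z (λ i → hRec i ys) j)

h-∷ʳ : ∀ (ys : Vec ℕ r) z j → h (suc j) (ys ∷ʳ z) ≡ h (suc j) ys + z * h j (ys ∷ʳ z)
h-∷ʳ ys z j = begin
  h (suc j) (ys ∷ʳ z)                  ≡⟨ h≡hRec (suc j) (ys ∷ʳ z) ⟩
  hRec (suc j) (ys ∷ʳ z)               ≡⟨ hRec-∷ʳ ys z (suc j) ⟩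
  hRec (suc j) ys + z * hRec j (z ∷ ys)
    ≡⟨ cong₂ (λ a b → a + z * b) (h≡hRec (suc j) ys) (trans (h≡hRec j (ys ∷ʳ z)) (hRec-∷ʳ ys z j)) ⟨
  h (suc j) ys + z * h j (ys ∷ʳ z)     ∎
  where open ≡-Reasoning

h-zero : ∀ (ys : Vec ℕ r) → h 0 ys ≡ 1
h-zero []       = refl
h-zero (y ∷ ys) = trans (h≡hRec 0 (y ∷ ys)) (trans (sym (h≡hRec 0 ys)) (h-zero ys))

hsub-∷ʳ : ∀ a b (ys : Vec ℕ r) z → hsub a b (ys ∷ʳ z) ≡ hsub a b ys + z * hsub a (suc b) (ys ∷ʳ z)
hsub-∷ʳ zero    zero    ys z = trans (h-zero (ys ∷ʳ z)) (sym (cong₂ _+_ (h-zero ys) (*-zeroʳ z)))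
hsub-∷ʳ (suc a) zero    ys z = h-∷ʳ ys z a
hsub-∷ʳ zero    (suc b) ys z = sym (*-zeroʳ z)
hsub-∷ʳ (suc a) (suc b) ys z = hsub-∷ʳ a b ys z

tabulate-∷ʳ : ∀ n (f : Fin (suc n) → A) → tabulate f ≡ tabulate (f ∘ inject₁) ∷ʳ f (fromℕ n)
tabulate-∷ʳ zero    f = refl
tabulate-∷ʳ (suc n) f = cong (f fzero ∷_) (tabulate-∷ʳ n (f ∘ fsuc))

tabulate-toℕ-∷ʳ : ∀ n (f : ℕ → A) → tabulate {n = suc n} (f ∘ toℕ) ≡ tabulate (f ∘ toℕ) ∷ʳ f n
tabulate-toℕ-∷ʳ n f = trans (tabulate-∷ʳ n (f ∘ toℕ))
  (cong₂ _∷ʳ_ (Vec.tabulate-cong (cong f ∘ Fin.toℕ-inject₁)) (cong f (Fin.toℕ-fromℕ n)))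

vars1-∷ʳ : ∀ m k → vars1 m (suc k) ≡ vars1 m k ∷ʳ (suc k * m + 1)
vars1-∷ʳ m k = tabulate-toℕ-∷ʳ (suc k) (λ i → i * m + 1)

vars2-∷ʳ : ∀ m k → vars2 m (suc k) ≡ vars2 m k ∷ʳ (suc k * m)
vars2-∷ʳ m k = tabulate-toℕ-∷ʳ k (λ i → suc i * m)

-- Boolean reflection and counting

isYes-elim : ∀ {P : Set} (d : Dec P) → isYes d ≡ true → P
isYes-elim (yes p) _ = p

isYes-intro : ∀ {P : Set} (d : Dec P) → P → isYes d ≡ true
isYes-intro (yes _) _ = refl
isYes-intro (no ¬p) p = contradiction p ¬p

∧-elim : ∀ {a b} → a ∧ b ≡ true → a ≡ true × b ≡ true
∧-elim {true} {true} _ = refl , refl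

∧-intro : ∀ {a b} → a ≡ true → b ≡ true → a ∧ b ≡ true
∧-intro refl refl = refl

∨-elim : ∀ {a b} → a ∨ b ≡ true → a ≡ true ⊎ b ≡ true
∨-elim {true}  _   = inj₁ refl
∨-elim {false} b≡t = inj₂ b≡t

∨-introˡ : ∀ {a b} → a ≡ true → a ∨ b ≡ true
∨-introˡ refl = refl

∨-introʳ : ∀ a {b} → b ≡ true → a ∨ b ≡ true
∨-introʳ true  _   = refl
∨-introʳ false b≡t = b≡t

not-∨-elim : ∀ {a b} → not a ∨ b ≡ true → a ≡ true → b ≡ true
not-∨-elim b≡t refl = b≡t

not-∨-intro : ∀ a {b} → (a ≡ true → b ≡ true) → not a ∨ b ≡ true
not-∨-intro true  a⇒b = a⇒b refl
not-∨-intro false _   = refl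

Bool-ext : ∀ {a b} → (a ≡ true → b ≡ true) → (b ≡ true → a ≡ true) → a ≡ b
Bool-ext {true}  {true}  _ _ = refl
Bool-ext {true}  {false} f _ = sym (f refl)
Bool-ext {false} {true}  _ g = g refl
Bool-ext {false} {false} _ _ = refl

≢true⇒≡false : ∀ {b} → ¬ b ≡ true → b ≡ false
≢true⇒≡false {true}  b≢t = contradiction refl b≢t
≢true⇒≡false {false} _   = refl

all-elim : ∀ (p : A → Bool) {xs} → all p xs ≡ true → ∀ {x} → x ∈ xs → p x ≡ true
all-elim p {x ∷ xs} all≡t (here refl) = proj₁ (∧-elim all≡t)
all-elim p {x ∷ xs} all≡t (there x∈)  = all-elim p (proj₂ (∧-elim {p x} all≡t)) x∈

all-intro : ∀ (p : A → Bool) xs → (∀ {x} → x ∈ xs → p x ≡ true) → all p xs ≡ true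
all-intro p []       _  = refl
all-intro p (x ∷ xs) px = ∧-intro (px (here refl)) (all-intro p xs (px ∘ there))

any-elim : ∀ (p : A → Bool) xs → any p xs ≡ true → ∃ λ x → x ∈ xs × p x ≡ true
any-elim p (x ∷ xs) any≡t with ∨-elim {p x} any≡t
... | inj₁ px = x , here refl , px
... | inj₂ rest with any-elim p xs rest
...   | y , y∈ , py = y , there y∈ , py

any-intro : ∀ (p : A → Bool) {xs x} → x ∈ xs → p x ≡ true → any p xs ≡ true
any-intro p {x ∷ xs} (here refl) px = ∨-introˡ px
any-intro p {y ∷ xs} (there x∈)  px = ∨-introʳ (p y) (any-intro p x∈ px)

allF-elim : ∀ N (p : Fin N → Bool) → allF N p ≡ true → ∀ x → p x ≡ true
allF-elim N p all≡t x = all-elim p all≡t (∈.∈-allFin x)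

allF-intro : ∀ N (p : Fin N → Bool) → (∀ x → p x ≡ true) → allF N p ≡ true
allF-intro N p px = all-intro p (allFin N) (λ {x} _ → px x)

anyF-elim : ∀ N (p : Fin N → Bool) → anyF N p ≡ true → ∃ λ x → p x ≡ true
anyF-elim N p any≡t with any-elim p (allFin N) any≡t
... | x , _ , px = x , px

anyF-intro : ∀ N (p : Fin N → Bool) x → p x ≡ true → anyF N p ≡ true
anyF-intro N p x = any-intro p (∈.∈-allFin x)

anyF-cases : ∀ N (p : Fin N → Bool) → (∃ λ x → p x ≡ true) ⊎ (∀ x → p x ≡ false)
anyF-cases N p with anyF N p in any≡
... | true  = inj₁ (anyF-elim N p any≡)
... | false = inj₂ (λ x → ≢true⇒≡false (λ px → contradiction (trans (sym (anyF-intro N p x px)) any≡) λ ()))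

∈-filterᵇ⁻ : ∀ (p : A → Bool) xs {z} → z ∈ filterᵇ p xs → z ∈ xs × p z ≡ true
∈-filterᵇ⁻ p xs z∈ with ∈.∈-filter⁻ (T? ∘ p) {xs = xs} z∈
... | z∈xs , pz = z∈xs , Equivalence.to T-≡ pz

∈-filterᵇ⁺ : ∀ (p : A → Bool) {xs z} → z ∈ xs → p z ≡ true → z ∈ filterᵇ p xs
∈-filterᵇ⁺ p z∈ pz = ∈.∈-filter⁺ (T? ∘ p) z∈ (Equivalence.from T-≡ pz)

Unique-filterᵇ : ∀ (p : A → Bool) {xs} → Unique xs → Unique (filterᵇ p xs)
Unique-filterᵇ p = Unique.filter⁺ (T? ∘ p)

length-unique-set : ∀ {xs ys : List A} → Unique xs → Unique ys → (∀ {z} → z ∈ xs ⇔ z ∈ ys) →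
  length xs ≡ length ys
length-unique-set xs! ys! xs∼ys = ↭-length (∼bag⇒↭ (unique∧set⇒bag xs! ys! xs∼ys))

count : (A → Bool) → List A → ℕ
count p xs = length (filterᵇ p xs)

count-cong : ∀ {p q : A → Bool} → (∀ x → p x ≡ q x) → ∀ xs → count p xs ≡ count q xs
count-cong {p = p} {q} p≗q xs =
  cong length (List.filter-≐ (T? ∘ p) (T? ∘ q) ((λ {x} → subst T (p≗q x)) , (λ {x} → subst T (sym (p≗q x)))) xs)

count-false : ∀ (xs : List A) → count (λ _ → false) xs ≡ 0
count-false []       = refl
count-false (x ∷ xs) = count-false xs

count-split : ∀ (p q : A → Bool) xs → count p xs ≡ count (λ x → p x ∧ not (q x)) xs + count (λ x → p x ∧ q x) xs
count-split p q []       = refl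
count-split p q (x ∷ xs) with p x | q x
... | true  | true  = trans (cong suc (count-split p q xs)) (sym (+-suc _ _))
... | true  | false = cong suc (count-split p q xs)
... | false | _     = count-split p q xs

count-∨ : ∀ (p q : A → Bool) xs → (∀ x → p x ≡ true → q x ≡ true → ⊥) →
  count (λ x → p x ∨ q x) xs ≡ count p xs + count q xs
count-∨ p q []       _        = refl
count-∨ p q (x ∷ xs) disjoint with p x in px | q x in qx
... | true  | true  = ⊥-elim (disjoint x px qx)
... | true  | false = cong suc (count-∨ p q xs disjoint)
... | false | true  = trans (cong suc (count-∨ p q xs disjoint)) (sym (+-suc _ _))
... | false | false = count-∨ p q xs disjoint

count-++ : ∀ (p : A → Bool) xs ys → count p (xs ++ ys) ≡ count p xs + count p ys
count-++ p xs ys = trans (cong length (List.filter-++ (T? ∘ p) xs ys)) (List.length-++ (filterᵇ p xs))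

count-map : ∀ (p : B → Bool) (f : A → B) xs → count p (map f xs) ≡ count (p ∘ f) xs
count-map p f []       = refl
count-map p f (x ∷ xs) with p (f x)
... | true  = cong suc (count-map p f xs)
... | false = count-map p f xs

count-cartesianProduct : ∀ (p : A → Bool) (q : A → B → Bool) c xs ys →
  (∀ x → p x ≡ true → count (q x) ys ≡ c) →
  count (λ (x , y) → p x ∧ q x y) (cartesianProduct xs ys) ≡ c * count p xs
count-cartesianProduct p q c []       ys q-count = sym (*-zeroʳ c)
count-cartesianProduct p q c (x ∷ xs) ys q-count =
  trans (count-++ _ (map (x ,_) ys) (cartesianProduct xs ys))
        (trans (cong₂ _+_ (count-map _ (x ,_) ys) (count-cartesianProduct p q c xs ys q-count)) (row (p x) refl))
  where
  row : ∀ b → p x ≡ b → count (λ y → p x ∧ q x y) ys + c * count p xs ≡ c * count p (x ∷ xs)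
  row true  px rewrite px = trans (cong (_+ c * count p xs) (q-count x px)) (sym (*-suc c _))
  row false px rewrite px = cong (_+ c * count p xs) (count-false ys)

count-bijection : ∀ {A B : Set} {LA : List A} {LB : List B} → Unique LA → Unique LB → (∀ a → a ∈ LA) → (∀ b → b ∈ LB) →
  (P : A → Bool) (Q : B → Bool) (f : A → B) (g : B → A) →
  (∀ a → P a ≡ true → Q (f a) ≡ true) → (∀ a → P a ≡ true → g (f a) ≡ a) →
  (∀ b → Q b ≡ true → P (g b) ≡ true) → (∀ b → Q b ≡ true → f (g b) ≡ b) →
  count P LA ≡ count Q LB
count-bijection {A} {B} {LA} {LB} LA! LB! ∈LA ∈LB P Q f g PQ gf QP fg = begin
  length FP           ≡⟨ List.length-map f FP ⟨
  length (map f FP)   ≡⟨ length-unique-set fFP! (Unique-filterᵇ Q LB!) (mk⇔ to from) ⟩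
  length FQ           ∎
  where
  open ≡-Reasoning
  FP : List A
  FP = filterᵇ P LA
  FQ : List B
  FQ = filterᵇ Q LB
  gfFP≡FP : map g (map f FP) ≡ FP
  gfFP≡FP = trans (sym (List.map-∘ FP)) (List.map-id-local (All.tabulate (λ a∈ → gf _ (proj₂ (∈-filterᵇ⁻ P LA a∈)))))
  fFP! : Unique (map f FP)
  fFP! = Unique.map⁻ (subst Unique (sym gfFP≡FP) (Unique-filterᵇ P LA!))
  to : ∀ {b} → b ∈ map f FP → b ∈ FQ
  to b∈ with ∈.∈-map⁻ f b∈
  ... | a , a∈ , refl = ∈-filterᵇ⁺ Q (∈LB (f a)) (PQ a (proj₂ (∈-filterᵇ⁻ P LA a∈)))
  from : ∀ {b} → b ∈ FQ → b ∈ map f FP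
  from {b} b∈ = subst (_∈ map f FP) (fg b Qb) (∈.∈-map⁺ f (∈-filterᵇ⁺ P (∈LA (g b)) (QP b Qb)))
    where Qb = proj₂ (∈-filterᵇ⁻ Q LB b∈)

-- Enumerating subsets and partitions

eqSub-sound : ∀ {S U : Subset K} → eqSub S U ≡ true → S ≡ U
eqSub-sound {S = S} {U} = isYes-elim (Vec.≡-dec Bool._≟_ S U)

eqSub-refl : ∀ (S : Subset K) → eqSub S S ≡ true
eqSub-refl S = isYes-intro (Vec.≡-dec Bool._≟_ S S) refl

eqFin-sound : ∀ {x y : Fin K} → eqFin x y ≡ true → x ≡ y
eqFin-sound {x = x} {y} = isYes-elim (x Fin.≟ y)

eqFin-refl : ∀ (x : Fin K) → eqFin x x ≡ true
eqFin-refl x = isYes-intro (x Fin.≟ x) refl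

eqFin-≢ : ∀ {x y : Fin K} → x ≢ y → eqFin x y ≡ false
eqFin-≢ x≢y = ≢true⇒≡false (x≢y ∘ eqFin-sound)

Vec-ext : ∀ {V W : Vec A K} → (∀ i → lookup V i ≡ lookup W i) → V ≡ W
Vec-ext {V = V} {W} V≗W = trans (sym (Vec.tabulate∘lookup V)) (trans (Vec.tabulate-cong V≗W) (Vec.tabulate∘lookup W))

concatMap-map≡cartesianProductWith : ∀ {B C : Set} (f : A → B → C) xs ys →
  concatMap (λ x → map (f x) ys) xs ≡ cartesianProductWith f xs ys
concatMap-map≡cartesianProductWith f []       ys = refl
concatMap-map≡cartesianProductWith f (x ∷ xs) ys = cong (map (f x) ys ++_) (concatMap-map≡cartesianProductWith f xs ys)

∈-allVecs : ∀ {xs : List A} → (∀ x → x ∈ xs) → ∀ {r} (v : Vec A r) → v ∈ allVecs xs r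
∈-allVecs ∈xs []      = here refl
∈-allVecs {xs = xs} ∈xs {suc r} (x ∷ v) = subst (x ∷ v ∈_) (sym (concatMap-map≡cartesianProductWith _∷_ xs _))
  (∈.∈-cartesianProductWith⁺ _∷_ (∈xs x) (∈-allVecs ∈xs v))

allVecs-unique : ∀ {xs : List A} → Unique xs → ∀ r → Unique (allVecs xs r)
allVecs-unique xs! zero    = [] ∷ []
allVecs-unique {xs = xs} xs! (suc r) = subst Unique (sym (concatMap-map≡cartesianProductWith _∷_ xs _))
  (Unique.cartesianProductWith⁺ _∷_ Vec.∷-injective xs! (allVecs-unique xs! r))

∈-bools : ∀ b → b ∈ true ∷ false ∷ []
∈-bools true  = here refl
∈-bools false = there (here refl)

bools-unique : Unique (true ∷ false ∷ [])
bools-unique = ((λ ()) ∷ []) ∷ [] ∷ []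

allSubsets : ∀ K → List (Subset K)
allSubsets K = allVecs (true ∷ false ∷ []) K

∈-allSubsets : ∀ (S : Subset K) → S ∈ allSubsets K
∈-allSubsets = ∈-allVecs ∈-bools

allSubsets-unique : ∀ K → Unique (allSubsets K)
allSubsets-unique = allVecs-unique bools-unique

∈-allParts : ∀ (B : Part K) → B ∈ allParts K
∈-allParts = ∈-allVecs ∈-allSubsets

allParts-unique : ∀ K → Unique (allParts K)
allParts-unique K = allVecs-unique (allSubsets-unique K) K

deduplicateᵇ-isYes : ∀ (_≟_ : DecidableEquality A) xs →
  deduplicateᵇ (λ x y → isYes (x ≟ y)) xs ≡ deduplicate _≟_ xs
deduplicateᵇ-isYes _≟_ []       = refl
deduplicateᵇ-isYes _≟_ (x ∷ xs) = cong (x ∷_) (trans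
  (cong (filter _) (deduplicateᵇ-isYes _≟_ xs))
  (List.filter-≐ (λ y → ¬? (T? (isYes (x ≟ y)))) (λ y → ¬? (x ≟ y))
     ((λ ¬t x≡y → ¬t (fromWitness x≡y)) , (λ x≢y t → x≢y (toWitness t))) (deduplicate _≟_ xs)))

blocks≡deduplicate : ∀ (B : Part K) → blocks B ≡ deduplicate (Vec.≡-dec Bool._≟_) (toList B)
blocks≡deduplicate B = deduplicateᵇ-isYes (Vec.≡-dec Bool._≟_) (toList B)

∈-blocks⁺ : ∀ (B : Part K) x → lookup B x ∈ blocks B
∈-blocks⁺ B x = subst (lookup B x ∈_) (sym (blocks≡deduplicate B))
  (∈.∈-deduplicate⁺ (Vec.≡-dec Bool._≟_) (Vec∈.∈-toList⁺ (Vec∈.∈-lookup x B)))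

∈-toList⇒lookup : ∀ {V : Vec A K} {S} → S ∈ toList V → ∃ λ x → S ≡ lookup V x
∈-toList⇒lookup S∈ = VecAny.index (Vec∈.∈-toList⁻ S∈) , VecAny.lookup-index (Vec∈.∈-toList⁻ S∈)

∈-blocks⁻ : ∀ (B : Part K) {S} → S ∈ blocks B → ∃ λ x → S ≡ lookup B x
∈-blocks⁻ B S∈ = ∈-toList⇒lookup (∈.∈-deduplicate⁻ (Vec.≡-dec Bool._≟_) (toList B) (subst (_ ∈_) (blocks≡deduplicate B) S∈))

blocks-unique : ∀ (B : Part K) → Unique (blocks B)
blocks-unique B = subst Unique (sym (blocks≡deduplicate B)) (deduplicate-! (toList B))
  where open import Data.List.Relation.Unary.Unique.DecPropositional.Properties (Vec.≡-dec Bool._≟_) using (deduplicate-!)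

isBlock-elim : ∀ (B : Part K) {S} → isBlock B S ≡ true → ∃ λ x → S ≡ lookup B x
isBlock-elim B {S} isB with any-elim (eqSub S) (blocks B) isB
... | U , U∈ , S≡U with ∈-blocks⁻ B U∈
...   | x , U≡Bx = x , trans (eqSub-sound S≡U) U≡Bx

isBlock-intro : ∀ (B : Part K) x → isBlock B (lookup B x) ≡ true
isBlock-intro B x = any-intro (eqSub (lookup B x)) (∈-blocks⁺ B x) (eqSub-refl _)

numBlocks-unique-set : ∀ (B : Part K) {L} → Unique L →
  (∀ {S} → S ∈ L → ∃ λ x → S ≡ lookup B x) → (∀ x → lookup B x ∈ L) → numBlocks B ≡ length L
numBlocks-unique-set B L! L⊆B B⊆L = length-unique-set (blocks-unique B) L! (mk⇔ to from)
  where
  to : ∀ {S} → S ∈ blocks B → S ∈ _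
  to S∈ with ∈-blocks⁻ B S∈
  ... | x , refl = B⊆L x
  from : ∀ {S} → S ∈ _ → S ∈ blocks B
  from S∈ with L⊆B S∈
  ... | x , refl = ∈-blocks⁺ B x

count-isBlock : ∀ (B : Part K) → count (isBlock B) (allSubsets K) ≡ numBlocks B
count-isBlock {K} B = length-unique-set (Unique-filterᵇ (isBlock B) (allSubsets-unique K)) (blocks-unique B) (mk⇔ to from)
  where
  to : ∀ {S} → S ∈ filterᵇ (isBlock B) (allSubsets K) → S ∈ blocks B
  to S∈ with isBlock-elim B (proj₂ (∈-filterᵇ⁻ (isBlock B) (allSubsets K) S∈))
  ... | x , refl = ∈-blocks⁺ B x
  from : ∀ {S} → S ∈ blocks B → S ∈ filterᵇ (isBlock B) (allSubsets K)
  from S∈ with ∈-blocks⁻ B S∈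
  ... | x , refl = ∈-filterᵇ⁺ (isBlock B) (∈-allSubsets _) (isBlock-intro B x)

count-eqSub : ∀ (T : Subset K) → count (λ S → eqSub S T) (allSubsets K) ≡ 1
count-eqSub {K} T = length-unique-set (Unique-filterᵇ (λ S → eqSub S T) (allSubsets-unique K)) ([] ∷ []) (mk⇔ to from)
  where
  to : ∀ {S} → S ∈ filterᵇ (λ S → eqSub S T) (allSubsets K) → S ∈ T ∷ []
  to S∈ = here (eqSub-sound (proj₂ (∈-filterᵇ⁻ (λ S → eqSub S T) (allSubsets K) S∈)))
  from : ∀ {S} → S ∈ T ∷ [] → S ∈ filterᵇ (λ S → eqSub S T) (allSubsets K)
  from (here refl) = ∈-filterᵇ⁺ (λ S → eqSub S T) (∈-allSubsets T) (eqSub-refl T)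

-- Colours and rotations

module Colours (m′ : ℕ) where

  m : ℕ
  m = suc m′

  infixl 6 _⊕_

  _⊕_ : Fin m → Fin m → Fin m
  c ⊕ a = (toℕ c + toℕ a) mod m

  ⊖_ : Fin m → Fin m
  ⊖ a = (m ∸ toℕ a) mod m

  private
    toℕ-mod : ∀ x → toℕ (x mod m) ≡ x % m
    toℕ-mod x = Fin.toℕ-fromℕ< (m%n<n x m)

    mod-cong : ∀ x y → x % m ≡ y % m → x mod m ≡ y mod m
    mod-cong x y eq = Fin.toℕ-injective (trans (toℕ-mod x) (trans eq (sym (toℕ-mod y))))

    %-absorbˡ : ∀ x y → (x % m + y) % m ≡ (x + y) % m
    %-absorbˡ x y = begin
      (x % m + y) % m           ≡⟨ %-distribˡ-+ (x % m) y m ⟩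
      (x % m % m + y % m) % m   ≡⟨ cong (λ t → (t + y % m) % m) (m%n%n≡m%n x m) ⟩
      (x % m + y % m) % m       ≡⟨ %-distribˡ-+ x y m ⟨
      (x + y) % m               ∎
      where open ≡-Reasoning

  toℕ-mod-id : ∀ (c : Fin m) → toℕ c mod m ≡ c
  toℕ-mod-id c = Fin.toℕ-injective (trans (toℕ-mod (toℕ c)) (m<n⇒m%n≡m (Fin.toℕ<n c)))

  ⊕-identityʳ : ∀ c → c ⊕ fzero ≡ c
  ⊕-identityʳ c = trans (cong (_mod m) (+-identityʳ (toℕ c))) (toℕ-mod-id c)

  ⊕-comm : ∀ a b → a ⊕ b ≡ b ⊕ a
  ⊕-comm a b = cong (_mod m) (+-comm (toℕ a) (toℕ b))

  ⊕-identityˡ : ∀ c → fzero ⊕ c ≡ c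
  ⊕-identityˡ c = trans (⊕-comm fzero c) (⊕-identityʳ c)

  ⊕-assoc : ∀ c a b → (c ⊕ a) ⊕ b ≡ c ⊕ (a ⊕ b)
  ⊕-assoc c a b = mod-cong (toℕ (c ⊕ a) + toℕ b) (toℕ c + toℕ (a ⊕ b)) (begin
    (toℕ ((toℕ c + toℕ a) mod m) + toℕ b) % m ≡⟨ cong (λ t → (t + toℕ b) % m) (toℕ-mod (toℕ c + toℕ a)) ⟩
    ((toℕ c + toℕ a) % m + toℕ b) % m        ≡⟨ %-absorbˡ (toℕ c + toℕ a) (toℕ b) ⟩
    (toℕ c + toℕ a + toℕ b) % m              ≡⟨ cong (_% m) (trans (+-assoc (toℕ c) _ _) (+-comm (toℕ c) _)) ⟩
    ((toℕ a + toℕ b) + toℕ c) % m            ≡⟨ %-absorbˡ (toℕ a + toℕ b) (toℕ c) ⟨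
    ((toℕ a + toℕ b) % m + toℕ c) % m        ≡⟨ cong (λ t → (t + toℕ c) % m) (toℕ-mod (toℕ a + toℕ b)) ⟨
    (toℕ ((toℕ a + toℕ b) mod m) + toℕ c) % m ≡⟨ cong (_% m) (+-comm _ (toℕ c)) ⟩
    (toℕ c + toℕ ((toℕ a + toℕ b) mod m)) % m ∎)
    where open ≡-Reasoning

  ⊕-inverseʳ : ∀ a → a ⊕ (⊖ a) ≡ fzero
  ⊕-inverseʳ a = mod-cong (toℕ a + toℕ (⊖ a)) 0 (begin
    (toℕ a + toℕ ((m ∸ toℕ a) mod m)) % m ≡⟨ cong (λ t → (toℕ a + t) % m) (toℕ-mod (m ∸ toℕ a)) ⟩
    (toℕ a + (m ∸ toℕ a) % m) % m         ≡⟨ cong (_% m) (+-comm (toℕ a) _) ⟩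
    ((m ∸ toℕ a) % m + toℕ a) % m         ≡⟨ %-absorbˡ (m ∸ toℕ a) (toℕ a) ⟩
    ((m ∸ toℕ a) + toℕ a) % m             ≡⟨ cong (_% m) (m∸n+n≡m (<⇒≤ (Fin.toℕ<n a))) ⟩
    m % m                                 ≡⟨ n%n≡0 m ⟩
    0                                     ∎)
    where open ≡-Reasoning

  ⊕-inverseˡ : ∀ a → (⊖ a) ⊕ a ≡ fzero
  ⊕-inverseˡ a = trans (⊕-comm (⊖ a) a) (⊕-inverseʳ a)

  ⊖-zero : ⊖ fzero ≡ fzero
  ⊖-zero = trans (sym (⊕-identityˡ (⊖ fzero))) (⊕-inverseʳ fzero)

  ⊕-cancelˡ : ∀ c {a b} → c ⊕ a ≡ c ⊕ b → a ≡ b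
  ⊕-cancelˡ c {a} {b} eq = begin
    a                 ≡⟨ ⊕-identityˡ a ⟨
    fzero ⊕ a         ≡⟨ cong (_⊕ a) (⊕-inverseˡ c) ⟨
    (⊖ c) ⊕ c ⊕ a     ≡⟨ ⊕-assoc (⊖ c) c a ⟩
    (⊖ c) ⊕ (c ⊕ a)   ≡⟨ cong ((⊖ c) ⊕_) eq ⟩
    (⊖ c) ⊕ (c ⊕ b)   ≡⟨ ⊕-assoc (⊖ c) c b ⟨
    (⊖ c) ⊕ c ⊕ b     ≡⟨ cong (_⊕ b) (⊕-inverseˡ c) ⟩
    fzero ⊕ b         ≡⟨ ⊕-identityˡ b ⟩
    b                 ∎
    where open ≡-Reasoning

  module Points (n : ℕ) where

    rotate : Fin m → Pt n m → Pt n m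
    rotate a = rot n m (toℕ a)

    rotate-col : ∀ a i c → rotate a (col n m i c) ≡ col n m i (c ⊕ a)
    rotate-col a i c = cong (λ (i′ , c′) → col n m i′ ((toℕ c′ + toℕ a) mod m)) (Fin.remQuot-combine {n} {m} i c)

    data PointView : Pt n m → Set where
      origin   : PointView fzero
      coloured : ∀ i c → PointView (col n m i c)

    pointView : ∀ x → PointView x
    pointView fzero    = origin
    pointView (fsuc y) = subst (PointView ∘ fsuc) (Fin.combine-remQuot {n} m y) (coloured _ _)

    rotate-⊕ : ∀ a b x → rotate b (rotate a x) ≡ rotate (a ⊕ b) x
    rotate-⊕ a b x with pointView x
    ... | origin       = refl
    ... | coloured i c = begin
      rotate b (rotate a (col n m i c)) ≡⟨ cong (rotate b) (rotate-col a i c) ⟩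
      rotate b (col n m i (c ⊕ a))      ≡⟨ rotate-col b i (c ⊕ a) ⟩
      col n m i (c ⊕ a ⊕ b)             ≡⟨ cong (col n m i) (⊕-assoc c a b) ⟩
      col n m i (c ⊕ (a ⊕ b))           ≡⟨ rotate-col (a ⊕ b) i c ⟨
      rotate (a ⊕ b) (col n m i c)      ∎
      where open ≡-Reasoning

    rotate-zero : ∀ x → rotate fzero x ≡ x
    rotate-zero x with pointView x
    ... | origin       = refl
    ... | coloured i c = trans (rotate-col fzero i c) (cong (col n m i) (⊕-identityʳ c))

    rotate-⊖ˡ : ∀ a x → rotate (⊖ a) (rotate a x) ≡ x
    rotate-⊖ˡ a x = trans (rotate-⊕ a (⊖ a) x) (trans (cong (λ t → rotate t x) (⊕-inverseʳ a)) (rotate-zero x))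

    rotate-⊖ʳ : ∀ a x → rotate a (rotate (⊖ a) x) ≡ x
    rotate-⊖ʳ a x = trans (rotate-⊕ (⊖ a) a x) (trans (cong (λ t → rotate t x) (⊕-inverseˡ a)) (rotate-zero x))

-- Coloured set partitions

rel : Part K → Fin K → Fin K → Bool
rel B x y = lookup (lookup B x) y

mkPart : (Fin K → Fin K → Bool) → Part K
mkPart f = tabulate (λ x → tabulate (f x))

rel-mkPart : ∀ (f : Fin K → Fin K → Bool) x y → rel (mkPart f) x y ≡ f x y
rel-mkPart f x y = trans (cong (λ v → lookup v y) (Vec.lookup∘tabulate _ x)) (Vec.lookup∘tabulate (f x) y)

Part-ext : ∀ {B C : Part K} → (∀ x y → rel B x y ≡ rel C x y) → B ≡ C
Part-ext B≗C = Vec-ext (λ x → Vec-ext (B≗C x))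

≡ᵇ-elim : ∀ {a b} → (a ≡ᵇ b) ≡ true → a ≡ b
≡ᵇ-elim {a} {b} eq = ≡ᵇ⇒≡ a b (subst Data.Bool.T (sym eq) _)

≡ᵇ-intro : ∀ {a b} → a ≡ b → (a ≡ᵇ b) ≡ true
≡ᵇ-intro {a} {b} eq with a ≡ᵇ b in eqᵇ | ≡⇒≡ᵇ a b eq
... | true | _ = refl

numBlocks-pullback : ∀ {K K′} {B : Part K} {C : Part K′} (φ : Fin K′ → Fin K) (ψ : Fin K → Fin K′) →
  (∀ x → φ (ψ x) ≡ x) → (∀ x y → rel C x y ≡ rel B (φ x) (φ y)) → numBlocks C ≡ numBlocks B
numBlocks-pullback {K} {K′} {B} {C} φ ψ φ∘ψ≗id C≡B∘φ =
  trans (numBlocks-unique-set C (Unique.map⁺ pullback-injective (blocks-unique B)) fromL toL)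
        (List.length-map pullback (blocks B))
  where
  pullback : Subset K → Subset K′
  pullback T = tabulate (lookup T ∘ φ)
  pullback-lookup : ∀ T x → lookup (pullback T) x ≡ lookup T (φ x)
  pullback-lookup T = Vec.lookup∘tabulate (lookup T ∘ φ)
  pullback-injective : ∀ {T U} → pullback T ≡ pullback U → T ≡ U
  pullback-injective {T} {U} eq = Vec-ext λ y → begin
    lookup T y              ≡⟨ cong (lookup T) (φ∘ψ≗id y) ⟨
    lookup T (φ (ψ y))      ≡⟨ pullback-lookup T (ψ y) ⟨
    lookup (pullback T) (ψ y) ≡⟨ cong (λ V → lookup V (ψ y)) eq ⟩
    lookup (pullback U) (ψ y) ≡⟨ pullback-lookup U (ψ y) ⟩
    lookup U (φ (ψ y))      ≡⟨ cong (lookup U) (φ∘ψ≗id y) ⟩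
    lookup U y              ∎
    where open ≡-Reasoning
  row : ∀ x → lookup C x ≡ pullback (lookup B (φ x))
  row x = Vec-ext (λ y → trans (C≡B∘φ x y) (sym (pullback-lookup (lookup B (φ x)) y)))
  fromL : ∀ {S} → S ∈ map pullback (blocks B) → ∃ λ x → S ≡ lookup C x
  fromL S∈ with ∈.∈-map⁻ pullback S∈
  ... | T , T∈ , refl with ∈-blocks⁻ B T∈
  ...   | z , refl = ψ z , trans (cong (pullback ∘ lookup B) (sym (φ∘ψ≗id z))) (sym (row (ψ z)))
  toL : ∀ x → lookup C x ∈ map pullback (blocks B)
  toL x = subst (_∈ map pullback (blocks B)) (sym (row x)) (∈.∈-map⁺ pullback (∈-blocks⁺ B (φ x)))

module Coloured (m′ : ℕ) where

  open Colours m′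

  module _ (n : ℕ) where

    open Points n

    N : ℕ
    N = suc (n * m)

    rotSet-lookup : ∀ (S : Subset N) a y → lookup (rotSet n m (toℕ a) S) y ≡ anyF N (λ s → lookup S s ∧ eqFin (rotate a s) y)
    rotSet-lookup S a y = Vec.lookup∘tabulate (λ y → anyF N (λ s → lookup S s ∧ eqFin (rotate a s) y)) y

    record IsInvariantEquivalence (B : Part N) : Set where
      field
        reflexive : ∀ x → rel B x x ≡ true
        rowsAgree : ∀ x y → rel B x y ≡ true → ∀ z → rel B y z ≡ rel B x z
        invariant : ∀ a x y → rel B x y ≡ true → rel B (rotate a x) (rotate a y) ≡ true

      symmetric : ∀ x y → rel B x y ≡ true → rel B y x ≡ true
      symmetric x y r = trans (rowsAgree x y r x) (reflexive x)

      transitive : ∀ x y z → rel B x y ≡ true → rel B y z ≡ true → rel B x z ≡ true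
      transitive x y z r s = trans (sym (rowsAgree x y r z)) s

      symmetric-≡ : ∀ x y → rel B x y ≡ rel B y x
      symmetric-≡ x y = Bool-ext (symmetric x y) (symmetric y x)

      row-≡ : ∀ x y → rel B x y ≡ true → lookup B x ≡ lookup B y
      row-≡ x y r = Vec-ext (λ z → sym (rowsAgree x y r z))

      row-≡⇒rel : ∀ x y → lookup B x ≡ lookup B y → rel B x y ≡ true
      row-≡⇒rel x y eq = trans (cong (λ v → lookup v y) eq) (reflexive y)

      invariant-≡ : ∀ a x y → rel B (rotate a x) (rotate a y) ≡ rel B x y
      invariant-≡ a x y = Bool-ext
        (λ r → subst₂ (λ u v → rel B u v ≡ true) (rotate-⊖ˡ a x) (rotate-⊖ˡ a y) (invariant (⊖ a) _ _ r))
        (invariant a x y)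

      rotSet-row : ∀ a x → rotSet n m (toℕ a) (lookup B x) ≡ lookup B (rotate a x)
      rotSet-row a x = Vec-ext (λ y → trans (rotSet-lookup (lookup B x) a y) (Bool-ext (to y) (from y)))
        where
        to : ∀ y → anyF _ (λ s → rel B x s ∧ eqFin (rotate a s) y) ≡ true → rel B (rotate a x) y ≡ true
        to y any≡t with anyF-elim _ _ any≡t
        ... | s , rs with ∧-elim rs
        ...   | r , eq = subst (λ t → rel B (rotate a x) t ≡ true) (eqFin-sound eq) (invariant a x s r)
        from : ∀ y → rel B (rotate a x) y ≡ true → anyF _ (λ s → rel B x s ∧ eqFin (rotate a s) y) ≡ true
        from y r = anyF-intro _ _ (rotate (⊖ a) y) (∧-intro
          (trans (sym (invariant-≡ a x _)) (trans (cong (rel B (rotate a x)) (rotate-⊖ʳ a y)) r))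
          (subst (λ t → eqFin t y ≡ true) (sym (rotate-⊖ʳ a y)) (eqFin-refl y)))

    record IsColouredPartition (B : Part N) : Set where
      field
        isInvariantEquivalence : IsInvariantEquivalence B
        orbitsSeparated : ∀ x → rel B fzero x ≡ false → ∀ a b → rel B (rotate a x) (rotate b x) ≡ true → a ≡ b

      open IsInvariantEquivalence isInvariantEquivalence public

      separated-≡ : ∀ x → rel B fzero x ≡ false → ∀ a b → rel B (rotate a x) (rotate b x) ≡ eqFin a b
      separated-≡ x x≁0 a b = Bool-ext
        (λ r → subst (λ t → eqFin a t ≡ true) (orbitsSeparated x x≁0 a b r) (eqFin-refl a))
        (λ eq → subst (λ t → rel B (rotate a x) (rotate t x) ≡ true) (eqFin-sound eq) (reflexive _))

    rowCondition : Part N → Fin N → Fin N → Bool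
    rowCondition B x y = not (rel B x y) ∨ eqSub (lookup B y) (lookup B x)

    isSetPartition-elim : ∀ B → isSetPartition B ≡ true →
      (∀ x → rel B x x ≡ true) × (∀ x y → rel B x y ≡ true → ∀ z → rel B y z ≡ rel B x z)
    isSetPartition-elim B isP = proj₁ ∘ row , rowsAgree
      where
      row : ∀ x → rel B x x ≡ true × allF N (rowCondition B x) ≡ true
      row x = ∧-elim {rel B x x} (allF-elim N (λ x → rel B x x ∧ allF N (rowCondition B x)) isP x)
      rowsAgree : ∀ x y → rel B x y ≡ true → ∀ z → rel B y z ≡ rel B x z
      rowsAgree x y r z =
        cong (λ v → lookup v z) (eqSub-sound (not-∨-elim (allF-elim N (rowCondition B x) (proj₂ (row x)) y) r))

    isSetPartition-intro : ∀ B → (∀ x → rel B x x ≡ true) →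
      (∀ x y → rel B x y ≡ true → ∀ z → rel B y z ≡ rel B x z) → isSetPartition B ≡ true
    isSetPartition-intro B reflexive rowsAgree =
      allF-intro N (λ x → rel B x x ∧ allF N (rowCondition B x)) (λ x → ∧-intro (reflexive x)
        (allF-intro N (rowCondition B x) (λ y → not-∨-intro (rel B x y) (λ r →
          subst (λ v → eqSub v (lookup B x) ≡ true) (Vec-ext (λ z → sym (rowsAgree x y r z))) (eqSub-refl (lookup B x))))))

    ZeroBlockClosed : Part N → Set
    ZeroBlockClosed B = ∀ i c → rel B fzero (col n m i c) ≡ true → ∀ d → rel B fzero (col n m i d) ≡ true

    inZeroBlock : Part N → Fin n → Fin m → Bool
    inZeroBlock B i d = rel B fzero (col n m i d)

    fibreCondition : Part N → Fin n → Fin m → Bool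
    fibreCondition B i c = not (inZeroBlock B i c) ∨ allF m (inZeroBlock B i)

    condI-elim : ∀ B → condI n m B ≡ true → ZeroBlockClosed B
    condI-elim B isI i c r = allF-elim m (inZeroBlock B i)
      (not-∨-elim (allF-elim m (fibreCondition B i) (allF-elim n (λ i → allF m (fibreCondition B i)) isI i) c) r)

    condI-intro : ∀ B → ZeroBlockClosed B → condI n m B ≡ true
    condI-intro B closed = allF-intro n (λ i → allF m (fibreCondition B i)) (λ i → allF-intro m (fibreCondition B i)
      (λ c → not-∨-intro (inZeroBlock B i c) (λ r → allF-intro m (inZeroBlock B i) (closed i c r))))

    OrbitOfBlocks : Part N → Subset N → Set
    OrbitOfBlocks B S = (∀ (a : Fin m) → ∃ λ z → rotSet n m (toℕ a) S ≡ lookup B z)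
                      × (∀ (a b : Fin m) → rotSet n m (toℕ a) S ≡ rotSet n m (toℕ b) S → a ≡ b)

    rotatedIsBlock : Part N → Subset N → Fin m → Bool
    rotatedIsBlock B S a = isBlock B (rotSet n m (toℕ a) S)

    rotationsDiffer : Subset N → Fin m → Fin m → Bool
    rotationsDiffer S a b = not (eqSub (rotSet n m (toℕ a) S) (rotSet n m (toℕ b) S)) ∨ eqFin a b

    orbitCondition : Part N → Subset N → Bool
    orbitCondition B S = allF m (rotatedIsBlock B S) ∧ allF m (λ a → allF m (rotationsDiffer S a))

    orbitCondition-elim : ∀ B S → orbitCondition B S ≡ true → OrbitOfBlocks B S
    orbitCondition-elim B S orbit = isBlock-elim B ∘ allF-elim m (rotatedIsBlock B S) (proj₁ parts) , distinct
      where
      parts : allF m (rotatedIsBlock B S) ≡ true × allF m (λ a → allF m (rotationsDiffer S a)) ≡ true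
      parts = ∧-elim {allF m (rotatedIsBlock B S)} orbit
      distinct : ∀ a b → rotSet n m (toℕ a) S ≡ rotSet n m (toℕ b) S → a ≡ b
      distinct a b eq = eqFin-sound (not-∨-elim
        (allF-elim m (rotationsDiffer S a) (allF-elim m (λ a → allF m (rotationsDiffer S a)) (proj₂ parts) a) b)
        (subst (λ T → eqSub (rotSet n m (toℕ a) S) T ≡ true) eq (eqSub-refl _)))

    orbitCondition-intro : ∀ B S → OrbitOfBlocks B S → orbitCondition B S ≡ true
    orbitCondition-intro B S (areBlocks , distinct) = ∧-intro
      (allF-intro m (rotatedIsBlock B S) (λ a → let z , eq = areBlocks a in
        subst (λ T → isBlock B T ≡ true) (sym eq) (isBlock-intro B z)))
      (allF-intro m (λ a → allF m (rotationsDiffer S a)) (λ a → allF-intro m (rotationsDiffer S a) (λ b →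
        not-∨-intro (eqSub _ _) (λ eq → subst (λ t → eqFin a t ≡ true) (distinct a b (eqSub-sound eq)) (eqFin-refl a)))))

    blockCondition : Part N → Subset N → Bool
    blockCondition B S = eqSub S (zeroBlock n m B) ∨ orbitCondition B S

    condII-elim : ∀ B → condII n m B ≡ true → ∀ x → lookup B x ≢ lookup B fzero → OrbitOfBlocks B (lookup B x)
    condII-elim B isII x notZero with ∨-elim {eqSub (lookup B x) (lookup B fzero)} (all-elim (blockCondition B) isII (∈-blocks⁺ B x))
    ... | inj₁ isZero = contradiction (eqSub-sound isZero) notZero
    ... | inj₂ orbit  = orbitCondition-elim B (lookup B x) orbit

    condII-intro : ∀ B → (∀ x → lookup B x ≢ lookup B fzero → OrbitOfBlocks B (lookup B x)) → condII n m B ≡ true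
    condII-intro B orbits = all-intro (blockCondition B) (blocks B) block
      where
      row : ∀ x b → eqSub (lookup B x) (lookup B fzero) ≡ b → blockCondition B (lookup B x) ≡ true
      row x true  isZero  = ∨-introˡ isZero
      row x false notZero = ∨-introʳ (eqSub _ _) (orbitCondition-intro B (lookup B x)
        (orbits x (λ eq → contradiction (trans (sym notZero) (subst (λ T → eqSub (lookup B x) T ≡ true) eq (eqSub-refl _))) λ ())))
      block : ∀ {S} → S ∈ blocks B → blockCondition B S ≡ true
      block S∈ with ∈-blocks⁻ B S∈
      ... | x , refl = row x (eqSub (lookup B x) (lookup B fzero)) refl

    rotSet-∋ : ∀ (S : Subset N) a s → lookup S s ≡ true → lookup (rotSet n m (toℕ a) S) (rotate a s) ≡ true
    rotSet-∋ S a s s∈S = trans (rotSet-lookup S a (rotate a s))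
      (anyF-intro N (λ s′ → lookup S s′ ∧ eqFin (rotate a s′) (rotate a s)) s (∧-intro s∈S (eqFin-refl _)))

    module FromConditions {B : Part N} (reflexive : ∀ x → rel B x x ≡ true)
      (rowsAgree : ∀ x y → rel B x y ≡ true → ∀ z → rel B y z ≡ rel B x z) (zeroClosed : ZeroBlockClosed B)
      (orbits : ∀ x → lookup B x ≢ lookup B fzero → OrbitOfBlocks B (lookup B x)) where

      symmetric : ∀ x y → rel B x y ≡ true → rel B y x ≡ true
      symmetric x y r = trans (rowsAgree x y r x) (reflexive x)

      transitive : ∀ x y z → rel B x y ≡ true → rel B y z ≡ true → rel B x z ≡ true
      transitive x y z r s = trans (sym (rowsAgree x y r z)) s

      otherRow : ∀ x → rel B fzero x ≡ false → lookup B x ≢ lookup B fzero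
      otherRow x x≁0 eq = contradiction (trans (sym x≁0) (trans (cong (λ v → lookup v x) (sym eq)) (reflexive x))) λ ()

      zeroBlock-rotate : ∀ a x → rel B fzero x ≡ true → rel B fzero (rotate a x) ≡ true
      zeroBlock-rotate a x x∼0 with pointView x
      ... | origin       = x∼0
      ... | coloured i c = subst (λ t → rel B fzero t ≡ true) (sym (rotate-col a i c)) (zeroClosed i c x∼0 (c ⊕ a))

      invariantBy : ∀ a x y b → rel B fzero x ≡ b → rel B x y ≡ true → rel B (rotate a x) (rotate a y) ≡ true
      invariantBy a x y true  x∼0 r = transitive _ fzero _ (symmetric fzero _ (zeroBlock-rotate a x x∼0))
                                                            (zeroBlock-rotate a y (transitive fzero x y x∼0 r))
      invariantBy a x y false x≁0 r = let z , rotSet≡ = proj₁ (orbits x (otherRow x x≁0)) a in transitive _ z _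
        (symmetric z _ (trans (cong (λ v → lookup v (rotate a x)) (sym rotSet≡)) (rotSet-∋ (lookup B x) a x (reflexive x))))
        (trans (cong (λ v → lookup v (rotate a y)) (sym rotSet≡)) (rotSet-∋ (lookup B x) a y r))

      isInvariantEquivalence : IsInvariantEquivalence B
      isInvariantEquivalence = record
        { reflexive = reflexive
        ; rowsAgree = rowsAgree
        ; invariant = λ a x y → invariantBy a x y (rel B fzero x) refl
        }

      open IsInvariantEquivalence isInvariantEquivalence using (rotSet-row; row-≡)

      isColouredPartition : IsColouredPartition B
      isColouredPartition = record
        { isInvariantEquivalence = isInvariantEquivalence
        ; orbitsSeparated = λ x x≁0 a b r → proj₂ (orbits x (otherRow x x≁0)) a b
            (trans (rotSet-row a x) (trans (row-≡ _ _ r) (sym (rotSet-row b x))))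
        }

    isColoredPartition-elim : ∀ k B → isColoredPartition m n k B ≡ true → IsColouredPartition B × numBlocks B ≡ k * m + 1
    isColoredPartition-elim k B isCP =
      let isSP , isCP′ = ∧-elim {isSetPartition B} isCP
          isI , isCP″ = ∧-elim {condI n m B} isCP′
          isII , isNB = ∧-elim {condII n m B} isCP″
          reflexive , rowsAgree = isSetPartition-elim B isSP
      in FromConditions.isColouredPartition reflexive rowsAgree (condI-elim B isI) (condII-elim B isII) , ≡ᵇ-elim isNB

    isColoredPartition-intro : ∀ k B → IsColouredPartition B → numBlocks B ≡ k * m + 1 → isColoredPartition m n k B ≡ true
    isColoredPartition-intro k B isColoured nb =
      ∧-intro (isSetPartition-intro B reflexive rowsAgree) (∧-intro (condI-intro B zeroClosed)
        (∧-intro (condII-intro B orbits) (≡ᵇ-intro nb)))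
      where
      open IsColouredPartition isColoured
      zeroClosed : ZeroBlockClosed B
      zeroClosed i c r d = subst (λ t → rel B fzero (col n m i t) ≡ true) c⊕[⊖c⊕d]≡d
        (subst (λ t → rel B fzero t ≡ true) (rotate-col ((⊖ c) ⊕ d) i c) (invariant ((⊖ c) ⊕ d) fzero _ r))
        where
        c⊕[⊖c⊕d]≡d : c ⊕ ((⊖ c) ⊕ d) ≡ d
        c⊕[⊖c⊕d]≡d = trans (sym (⊕-assoc c (⊖ c) d)) (trans (cong (_⊕ d) (⊕-inverseʳ c)) (⊕-identityˡ d))
      orbits : ∀ x → lookup B x ≢ lookup B fzero → OrbitOfBlocks B (lookup B x)
      orbits x notZero = (λ a → rotate a x , rotSet-row a x) , (λ a b eq → orbitsSeparated x x≁0 a b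
          (row-≡⇒rel _ _ (trans (sym (rotSet-row a x)) (trans eq (rotSet-row b x)))))
        where
        x≁0 : rel B fzero x ≡ false
        x≁0 = ≢true⇒≡false (λ x∼0 → notZero (sym (row-≡ fzero x x∼0)))

  module _ {n n′ : ℕ} (φ : Pt n′ m → Pt n m) (φ-origin : φ fzero ≡ fzero)
           (φ-rotate : ∀ a x → φ (Points.rotate n′ a x) ≡ Points.rotate n a (φ x)) where

    pullback-coloured : ∀ {B C} → (∀ x y → rel C x y ≡ rel B (φ x) (φ y)) →
      IsColouredPartition n B → IsColouredPartition n′ C
    pullback-coloured {B} {C} C≡B∘φ isColoured = record
      { isInvariantEquivalence = record
        { reflexive = λ x → trans (C≡B∘φ x x) (reflexive (φ x))
        ; rowsAgree = λ x y r z → trans (C≡B∘φ y z)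
            (trans (rowsAgree (φ x) (φ y) (trans (sym (C≡B∘φ x y)) r) (φ z)) (sym (C≡B∘φ x z)))
        ; invariant = λ a x y r → trans (C≡B∘φ _ _) (trans (cong₂ (rel B) (φ-rotate a x) (φ-rotate a y))
            (invariant a (φ x) (φ y) (trans (sym (C≡B∘φ x y)) r)))
        }
      ; orbitsSeparated = λ x x≁0 a b r → orbitsSeparated (φ x)
          (trans (cong (λ t → rel B t (φ x)) (sym φ-origin)) (trans (sym (C≡B∘φ fzero x)) x≁0)) a b
          (trans (sym (cong₂ (rel B) (φ-rotate a x) (φ-rotate b x))) (trans (sym (C≡B∘φ _ _)) r))
      }
      where open IsColouredPartition isColoured

  module _ {n : ℕ} {B : Part (suc (n * m))} (isColoured : IsColouredPartition n B) where
    open Points n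
    open IsColouredPartition isColoured

    rel-rotations : ∀ s c d → rel B (rotate c s) (rotate d s) ≡ eqFin c d ∨ rel B s fzero
    rel-rotations s c d with rel B fzero s in s∼0
    ... | true  = trans (transitive _ fzero _ (symmetric fzero _ (invariant c fzero s s∼0)) (invariant d fzero s s∼0))
                        (sym (trans (cong (eqFin c d ∨_) (trans (symmetric-≡ s fzero) s∼0)) (∨-zeroʳ (eqFin c d))))
    ... | false = trans (separated-≡ s s∼0 c d)
                        (sym (trans (cong (eqFin c d ∨_) (trans (symmetric-≡ s fzero) s∼0)) (∨-identityʳ (eqFin c d))))

-- Adding the point n + 1

module Extension (m′ n : ℕ) where

  open Colours m′
  open Coloured m′
  private
    module P₀ = Points n
    module P₁ = Points (suc n)

  N₀ N₁ : ℕ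
  N₀ = suc (n * m)
  N₁ = suc (suc n * m)

  old : Fin N₀ → Fin N₁
  old fzero    = fzero
  old (fsuc x) = fsuc (m ↑ʳ x)

  -- The point (n+1)^c.
  new : Fin m → Fin N₁
  new c = fsuc (c ↑ˡ (n * m))

  classify : Fin N₁ → Fin N₀ ⊎ Fin m
  classify fzero    = inj₁ fzero
  classify (fsuc y) = [ inj₂ , inj₁ ∘ fsuc ]′ (splitAt m y)

  classify-old : ∀ x → classify (old x) ≡ inj₁ x
  classify-old fzero    = refl
  classify-old (fsuc x) rewrite Fin.splitAt-↑ʳ m (n * m) x = refl

  classify-new : ∀ c → classify (new c) ≡ inj₂ c
  classify-new c rewrite Fin.splitAt-↑ˡ m c (n * m) = refl

  data Classified : Fin N₁ → Set where
    isOld : ∀ x → Classified (old x)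
    isNew : ∀ c → Classified (new c)

  classified : ∀ x → Classified x
  classified fzero    = isOld fzero
  classified (fsuc y) with splitAt m y in eq
  ... | inj₁ c = subst (Classified ∘ fsuc) (Fin.splitAt⁻¹-↑ˡ eq) (isNew c)
  ... | inj₂ x = subst (Classified ∘ fsuc) (Fin.splitAt⁻¹-↑ʳ eq) (isOld (fsuc x))

  old-injective : ∀ {x y} → old x ≡ old y → x ≡ y
  old-injective {x} {y} eq = inj₁-injective (trans (sym (classify-old x)) (trans (cong classify eq) (classify-old y)))

  old≢new : ∀ x c → old x ≢ new c
  old≢new x c eq with trans (sym (classify-old x)) (trans (cong classify eq) (classify-new c))
  ... | ()

  rotate-old : ∀ a x → P₁.rotate a (old x) ≡ old (P₀.rotate a x)
  rotate-old a x with P₀.pointView x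
  ... | P₀.origin       = refl
  ... | P₀.coloured i c = trans (P₁.rotate-col a (fsuc i) c) (cong old (sym (P₀.rotate-col a i c)))

  rotate-new : ∀ a c → P₁.rotate a (new c) ≡ new (c ⊕ a)
  rotate-new a c = P₁.rotate-col a fzero c

  rotate-new-zero : ∀ c → P₁.rotate c (new fzero) ≡ new c
  rotate-new-zero c = trans (rotate-new c fzero) (cong new (⊕-identityˡ c))

  restrict : Part N₁ → Part N₀
  restrict B = mkPart (λ x y → rel B (old x) (old y))

  rel-restrict : ∀ B x y → rel (restrict B) x y ≡ rel B (old x) (old y)
  rel-restrict B = rel-mkPart _

  link : Part N₁ → Subset N₀
  link B = tabulate (λ y → rel B (new fzero) (old y))

  link-lookup : ∀ B y → lookup (link B) y ≡ rel B (new fzero) (old y)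
  link-lookup B = Vec.lookup∘tabulate _

  -- (n+1)^c joins y iff ζ^(-c) y ∈ S, and the new points are joined to each other only inside the zero block.
  extendedRel : Part N₀ → Subset N₀ → Fin N₀ ⊎ Fin m → Fin N₀ ⊎ Fin m → Bool
  extendedRel B S (inj₁ x) (inj₁ y) = rel B x y
  extendedRel B S (inj₁ x) (inj₂ d) = lookup S (P₀.rotate (⊖ d) x)
  extendedRel B S (inj₂ c) (inj₁ y) = lookup S (P₀.rotate (⊖ c) y)
  extendedRel B S (inj₂ c) (inj₂ d) = eqFin c d ∨ lookup S fzero

  extend : Part N₀ → Subset N₀ → Part N₁
  extend B S = mkPart (λ x y → extendedRel B S (classify x) (classify y))

  rel-extend : ∀ B S x y → rel (extend B S) x y ≡ extendedRel B S (classify x) (classify y)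
  rel-extend B S = rel-mkPart _

  rel-extend-old-old : ∀ B S x y → rel (extend B S) (old x) (old y) ≡ rel B x y
  rel-extend-old-old B S x y = trans (rel-extend B S (old x) (old y)) (cong₂ (extendedRel B S) (classify-old x) (classify-old y))

  rel-extend-old-new : ∀ B S x d → rel (extend B S) (old x) (new d) ≡ lookup S (P₀.rotate (⊖ d) x)
  rel-extend-old-new B S x d = trans (rel-extend B S (old x) (new d)) (cong₂ (extendedRel B S) (classify-old x) (classify-new d))

  rel-extend-new-old : ∀ B S c y → rel (extend B S) (new c) (old y) ≡ lookup S (P₀.rotate (⊖ c) y)
  rel-extend-new-old B S c y = trans (rel-extend B S (new c) (old y)) (cong₂ (extendedRel B S) (classify-new c) (classify-old y))

  rel-extend-new-new : ∀ B S c d → rel (extend B S) (new c) (new d) ≡ eqFin c d ∨ lookup S fzero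
  rel-extend-new-new B S c d = trans (rel-extend B S (new c) (new d)) (cong₂ (extendedRel B S) (classify-new c) (classify-new d))

  restrict-extend : ∀ B S → restrict (extend B S) ≡ B
  restrict-extend B S = Part-ext (λ x y → trans (rel-restrict (extend B S) x y) (rel-extend-old-old B S x y))

  link-extend : ∀ B S → link (extend B S) ≡ S
  link-extend B S = Vec-ext λ y → begin
    lookup (link (extend B S)) y               ≡⟨ link-lookup (extend B S) y ⟩
    rel (extend B S) (new fzero) (old y)       ≡⟨ rel-extend-new-old B S fzero y ⟩
    lookup S (P₀.rotate (⊖ fzero) y)           ≡⟨ cong (λ a → lookup S (P₀.rotate a y)) ⊖-zero ⟩
    lookup S (P₀.rotate fzero y)               ≡⟨ cong (lookup S) (P₀.rotate-zero y) ⟩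
    lookup S y                                 ∎
    where open ≡-Reasoning

  restrict-coloured : ∀ {B} → IsColouredPartition (suc n) B → IsColouredPartition n (restrict B)
  restrict-coloured {B} = pullback-coloured old refl (λ a x → sym (rotate-old a x)) {B} (rel-restrict B)

  module NewPoints {B : Part N₁} (isColoured : IsColouredPartition (suc n) B) where
    open IsColouredPartition isColoured

    rel-new-old : ∀ c y → rel B (new fzero) (P₁.rotate (⊖ c) (old y)) ≡ rel B (new c) (old y)
    rel-new-old c y = trans (sym (invariant-≡ c (new fzero) _)) (cong₂ (rel B) (rotate-new-zero c) (P₁.rotate-⊖ʳ c (old y)))

    rel-zero-new : ∀ c → rel B fzero (new c) ≡ rel B fzero (new fzero)
    rel-zero-new c = trans (cong (rel B fzero) (sym (rotate-new-zero c))) (invariant-≡ c fzero (new fzero))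

    rel-new-new : ∀ c d → rel B (new c) (new d) ≡ eqFin c d ∨ rel B (new fzero) fzero
    rel-new-new c d = trans (sym (cong₂ (rel B) (rotate-new-zero c) (rotate-new-zero d))) (rel-rotations isColoured (new fzero) c d)

  extend-restrict : ∀ {B} → IsColouredPartition (suc n) B → extend (restrict B) (link B) ≡ B
  extend-restrict {B} isColoured = Part-ext agree
    where
    open IsColouredPartition isColoured
    open NewPoints isColoured
    link-rotated : ∀ c y → lookup (link B) (P₀.rotate (⊖ c) y) ≡ rel B (new c) (old y)
    link-rotated c y = trans (link-lookup B _) (trans (cong (rel B (new fzero)) (sym (rotate-old (⊖ c) y))) (rel-new-old c y))
    agree : ∀ x y → rel (extend (restrict B) (link B)) x y ≡ rel B x y
    agree x y with classified x | classified y
    ... | isOld x | isOld y = trans (rel-extend-old-old _ _ x y) (rel-restrict B x y)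
    ... | isOld x | isNew d = trans (rel-extend-old-new _ _ x d) (trans (link-rotated d x) (symmetric-≡ (new d) (old x)))
    ... | isNew c | isOld y = trans (rel-extend-new-old _ _ c y) (link-rotated c y)
    ... | isNew c | isNew d = trans (rel-extend-new-new _ _ c d)
                                (trans (cong (eqFin c d ∨_) (link-lookup B fzero)) (sym (rel-new-new c d)))

  module JoinBlock {B : Part N₀} (isColoured : IsColouredPartition n B) (s : Fin N₀) where
    open IsColouredPartition isColoured

    project : Fin N₁ → Fin N₀
    project x = [ id , (λ c → P₀.rotate c s) ]′ (classify x)

    project-old : ∀ x → project (old x) ≡ x
    project-old x = cong [ id , (λ c → P₀.rotate c s) ]′ (classify-old x)

    project-new : ∀ c → project (new c) ≡ P₀.rotate c s
    project-new c = cong [ id , (λ c → P₀.rotate c s) ]′ (classify-new c)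

    project-rotate : ∀ a x → project (P₁.rotate a x) ≡ P₀.rotate a (project x)
    project-rotate a x with classified x
    ... | isOld x = trans (cong project (rotate-old a x)) (trans (project-old _) (cong (P₀.rotate a) (sym (project-old x))))
    ... | isNew c = trans (cong project (rotate-new a c))
      (trans (project-new _) (trans (sym (P₀.rotate-⊕ c a s)) (cong (P₀.rotate a) (sym (project-new c)))))

    block-rotated : ∀ c y → lookup (lookup B s) (P₀.rotate (⊖ c) y) ≡ rel B (P₀.rotate c s) y
    block-rotated c y = trans (sym (invariant-≡ c s _)) (cong (rel B (P₀.rotate c s)) (P₀.rotate-⊖ʳ c y))

    rel-extend-project : ∀ x y → rel (extend B (lookup B s)) x y ≡ rel B (project x) (project y)
    rel-extend-project x y with classified x | classified y
    ... | isOld x | isOld y = trans (rel-extend-old-old B _ x y) (sym (cong₂ (rel B) (project-old x) (project-old y)))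
    ... | isOld x | isNew d = trans (rel-extend-old-new B _ x d)
      (trans (block-rotated d x) (trans (symmetric-≡ _ x) (sym (cong₂ (rel B) (project-old x) (project-new d)))))
    ... | isNew c | isOld y = trans (rel-extend-new-old B _ c y)
      (trans (block-rotated c y) (sym (cong₂ (rel B) (project-new c) (project-old y))))
    ... | isNew c | isNew d = trans (rel-extend-new-new B _ c d)
      (trans (sym (rel-rotations isColoured s c d)) (sym (cong₂ (rel B) (project-new c) (project-new d))))

    extend-coloured : IsColouredPartition (suc n) (extend B (lookup B s))
    extend-coloured = pullback-coloured project refl project-rotate {B} rel-extend-project isColoured

    numBlocks-extend : numBlocks (extend B (lookup B s)) ≡ numBlocks B
    numBlocks-extend = numBlocks-pullback {B = B} project old project-old rel-extend-project

  ∅-lookup : ∀ y → lookup (∅ {N₀}) y ≡ false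
  ∅-lookup y = Vec.lookup-replicate y false

  module NewOrbit {B : Part N₀} (isColoured : IsColouredPartition n B) where
    open IsColouredPartition isColoured

    C : Part N₁
    C = extend B ∅

    rel-old-old : ∀ x y → rel C (old x) (old y) ≡ rel B x y
    rel-old-old = rel-extend-old-old B ∅

    rel-old-new : ∀ x d → rel C (old x) (new d) ≡ false
    rel-old-new x d = trans (rel-extend-old-new B ∅ x d) (∅-lookup (P₀.rotate (⊖ d) x))

    rel-new-old : ∀ c y → rel C (new c) (old y) ≡ false
    rel-new-old c y = trans (rel-extend-new-old B ∅ c y) (∅-lookup (P₀.rotate (⊖ c) y))

    rel-new-new : ∀ c d → rel C (new c) (new d) ≡ eqFin c d
    rel-new-new c d = trans (rel-extend-new-new B ∅ c d) (trans (cong (eqFin c d ∨_) (∅-lookup fzero)) (∨-identityʳ _))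

    private
      false≢true : false ≢ true
      false≢true ()

    reflexive′ : ∀ x → rel C x x ≡ true
    reflexive′ x with classified x
    ... | isOld x = trans (rel-old-old x x) (reflexive x)
    ... | isNew c = trans (rel-new-new c c) (eqFin-refl c)

    rowsAgree′ : ∀ x y → rel C x y ≡ true → ∀ z → rel C y z ≡ rel C x z
    rowsAgree′ x y r z with classified x | classified y
    rowsAgree′ _ _ r z | isOld x | isOld y with classified z
    ... | isOld z = trans (rel-old-old y z) (trans (rowsAgree x y (trans (sym (rel-old-old x y)) r) z) (sym (rel-old-old x z)))
    ... | isNew d = trans (rel-old-new y d) (sym (rel-old-new x d))
    rowsAgree′ _ _ r z | isOld x | isNew d = contradiction (trans (sym (rel-old-new x d)) r) false≢true
    rowsAgree′ _ _ r z | isNew c | isOld y = contradiction (trans (sym (rel-new-old c y)) r) false≢true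
    rowsAgree′ _ _ r z | isNew c | isNew d = cong (λ t → rel C (new t) z) (sym (eqFin-sound (trans (sym (rel-new-new c d)) r)))

    invariant′ : ∀ a x y → rel C x y ≡ true → rel C (P₁.rotate a x) (P₁.rotate a y) ≡ true
    invariant′ a x y r with classified x | classified y
    ... | isOld x | isOld y = trans (cong₂ (rel C) (rotate-old a x) (rotate-old a y))
                                (trans (rel-old-old _ _) (invariant a x y (trans (sym (rel-old-old x y)) r)))
    ... | isOld x | isNew d = contradiction (trans (sym (rel-old-new x d)) r) false≢true
    ... | isNew c | isOld y = contradiction (trans (sym (rel-new-old c y)) r) false≢true
    ... | isNew c | isNew d = subst (λ t → rel C (P₁.rotate a (new c)) (P₁.rotate a (new t)) ≡ true)
                                (eqFin-sound (trans (sym (rel-new-new c d)) r)) (reflexive′ (P₁.rotate a (new c)))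

    separated′ : ∀ x → rel C fzero x ≡ false → ∀ a b → rel C (P₁.rotate a x) (P₁.rotate b x) ≡ true → a ≡ b
    separated′ x x≁0 a b r with classified x
    ... | isOld x = orbitsSeparated x (trans (sym (rel-old-old fzero x)) x≁0) a b
                      (trans (sym (rel-old-old _ _)) (trans (sym (cong₂ (rel C) (rotate-old a x) (rotate-old b x))) r))
    ... | isNew c = ⊕-cancelˡ c (eqFin-sound (trans (sym (rel-new-new (c ⊕ a) (c ⊕ b)))
                      (trans (sym (cong₂ (rel C) (rotate-new a c) (rotate-new b c))) r)))

    extend-coloured : IsColouredPartition (suc n) C
    extend-coloured = record
      { isInvariantEquivalence = record { reflexive = reflexive′ ; rowsAgree = rowsAgree′ ; invariant = invariant′ }
      ; orbitsSeparated = separated′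
      }

    widenedLookup : Subset N₀ → Fin N₁ → Bool
    widenedLookup T y = [ lookup T , (λ _ → false) ]′ (classify y)

    widen : Subset N₀ → Subset N₁
    widen T = tabulate (widenedLookup T)

    widen-old : ∀ T y → lookup (widen T) (old y) ≡ lookup T y
    widen-old T y = trans (Vec.lookup∘tabulate (widenedLookup T) (old y)) (cong [ lookup T , (λ _ → false) ]′ (classify-old y))

    widen-new : ∀ T c → lookup (widen T) (new c) ≡ false
    widen-new T c = trans (Vec.lookup∘tabulate (widenedLookup T) (new c)) (cong [ lookup T , (λ _ → false) ]′ (classify-new c))

    row-old : ∀ x → lookup C (old x) ≡ widen (lookup B x)
    row-old x = Vec-ext agree
      where
      agree : ∀ y → rel C (old x) y ≡ lookup (widen (lookup B x)) y
      agree y with classified y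
      ... | isOld y = trans (rel-old-old x y) (sym (widen-old (lookup B x) y))
      ... | isNew d = trans (rel-old-new x d) (sym (widen-new (lookup B x) d))

    newRow : Fin m → Subset N₁
    newRow c = lookup C (new c)

    newRows oldRows : List (Subset N₁)
    newRows = map newRow (allFin m)
    oldRows = map widen (blocks B)

    numBlocks-extend : numBlocks C ≡ m + numBlocks B
    numBlocks-extend = trans (numBlocks-unique-set C unique fromL toL) (begin
      length (newRows ++ oldRows)         ≡⟨ List.length-++ newRows ⟩
      length newRows + length oldRows     ≡⟨ cong₂ _+_ (trans (List.length-map newRow (allFin m)) (List.length-tabulate id))
                                                       (List.length-map widen (blocks B)) ⟩
      m + numBlocks B                     ∎)
      where
      open ≡-Reasoning
      newRow-injective : ∀ {c d} → lookup C (new c) ≡ lookup C (new d) → c ≡ d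
      newRow-injective {c} {d} eq = eqFin-sound (trans (sym (rel-new-new c d))
        (trans (cong (λ V → lookup V (new d)) eq) (reflexive′ (new d))))
      widen-injective : ∀ {T U} → widen T ≡ widen U → T ≡ U
      widen-injective {T} {U} eq = Vec-ext (λ y → trans (sym (widen-old T y))
        (trans (cong (λ V → lookup V (old y)) eq) (widen-old U y)))
      disjoint : ∀ {S} → S ∈ newRows × S ∈ oldRows → ⊥
      disjoint (S∈new , S∈old) with ∈.∈-map⁻ newRow {xs = allFin m} S∈new | ∈.∈-map⁻ widen {xs = blocks B} S∈old
      ... | c , _ , refl | T , _ , eq = contradiction
        (trans (sym (reflexive′ (new c))) (trans (cong (λ V → lookup V (new c)) eq) (widen-new T c))) λ ()
      unique : Unique (newRows ++ oldRows)
      unique = Unique.++⁺ (Unique.map⁺ newRow-injective (Unique.allFin⁺ m)) (Unique.map⁺ widen-injective (blocks-unique B)) disjoint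
      fromL : ∀ {S} → S ∈ newRows ++ oldRows → ∃ λ x → S ≡ lookup C x
      fromL S∈ with ∈.∈-++⁻ newRows S∈
      ... | inj₁ S∈new with ∈.∈-map⁻ newRow {xs = allFin m} S∈new
      ...   | c , _ , S≡ = new c , S≡
      fromL S∈ | inj₂ S∈old with ∈.∈-map⁻ widen {xs = blocks B} S∈old
      ...   | T , T∈ , refl with ∈-blocks⁻ B T∈
      ...     | x , refl = old x , sym (row-old x)
      toL : ∀ x → lookup C x ∈ newRows ++ oldRows
      toL x with classified x
      ... | isOld x = ∈.∈-++⁺ʳ newRows (subst (_∈ oldRows) (sym (row-old x)) (∈.∈-map⁺ widen (∈-blocks⁺ B x)))
      ... | isNew c = ∈.∈-++⁺ˡ (∈.∈-map⁺ newRow (∈.∈-allFin c))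

  module Link {B : Part N₁} (isColoured : IsColouredPartition (suc n) B) where
    open IsColouredPartition isColoured

    link-zero : rel B fzero (new fzero) ≡ true → link B ≡ lookup (restrict B) fzero
    link-zero r = Vec-ext (λ y → trans (link-lookup B y) (trans (rowsAgree fzero (new fzero) r (old y)) (sym (rel-restrict B fzero y))))

    link-block : ∀ y → rel B (new fzero) (old y) ≡ true → link B ≡ lookup (restrict B) y
    link-block y r = Vec-ext (λ z → trans (link-lookup B z)
      (trans (sym (rowsAgree (new fzero) (old y) r (old z))) (sym (rel-restrict B y z))))

    link-empty : (∀ y → rel B (new fzero) (old y) ≡ false) → link B ≡ ∅
    link-empty unlinked = Vec-ext (λ y → trans (link-lookup B y) (trans (unlinked y) (sym (∅-lookup y))))

-- The recurrence

module BlockCount (m′ : ℕ) where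
  open Colours m′
  open Coloured m′

  module _ {n k} {B : Part (suc (n * m))} (isCP : isColoredPartition m n k B ≡ true) where

    private
      isColoured : IsColouredPartition n B
      isColoured = proj₁ (isColoredPartition-elim n k B isCP)
      open IsColouredPartition isColoured

    count-zeroBlock : count (λ S → isBlock B S ∧ lookup S fzero) (allSubsets (suc (n * m))) ≡ 1
    count-zeroBlock = length-unique-set (Unique-filterᵇ _ (allSubsets-unique _)) ([] ∷ []) (mk⇔ to from)
      where
      to : ∀ {S} → S ∈ filterᵇ (λ S → isBlock B S ∧ lookup S fzero) (allSubsets _) → S ∈ lookup B fzero ∷ []
      to {S} S∈ with ∧-elim {isBlock B S} (proj₂ (∈-filterᵇ⁻ _ (allSubsets _) S∈))
      ... | isB , S∋0 with isBlock-elim B {S} isB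
      ...   | x , refl = here (row-≡ x fzero S∋0)
      from : ∀ {S} → S ∈ lookup B fzero ∷ [] → S ∈ filterᵇ (λ S → isBlock B S ∧ lookup S fzero) (allSubsets _)
      from (here refl) = ∈-filterᵇ⁺ _ (∈-allSubsets _) (∧-intro (isBlock-intro B fzero) (reflexive fzero))

    count-nonzeroBlocks : count (λ S → isBlock B S ∧ not (lookup S fzero)) (allSubsets (suc (n * m))) ≡ k * m
    count-nonzeroBlocks = +-cancelʳ-≡ 1 _ _ (begin
      count (λ S → isBlock B S ∧ not (lookup S fzero)) Subsets + 1
        ≡⟨ cong (count (λ S → isBlock B S ∧ not (lookup S fzero)) Subsets +_) count-zeroBlock ⟨
      count (λ S → isBlock B S ∧ not (lookup S fzero)) Subsets + count (λ S → isBlock B S ∧ lookup S fzero) Subsets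
        ≡⟨ count-split (isBlock B) (λ S → lookup S fzero) Subsets ⟨
      count (isBlock B) Subsets
        ≡⟨ count-isBlock B ⟩
      numBlocks B
        ≡⟨ proj₂ (isColoredPartition-elim n k B isCP) ⟩
      k * m + 1 ∎)
      where
      open ≡-Reasoning
      Subsets : List (Subset (suc (n * m)))
      Subsets = allSubsets (suc (n * m))

module Recurrence (m′ n : ℕ) where
  open Colours m′
  open Coloured m′
  open Extension m′ n
  open BlockCount m′

  isCP₀ : ℕ → Part N₀ → Bool
  isCP₀ k = isColoredPartition m n k

  isCP₁ : ℕ → Part N₁ → Bool
  isCP₁ k = isColoredPartition m (suc n) k

  isCP₀-pred : ℕ → Part N₀ → Bool
  isCP₀-pred zero    _ = false
  isCP₀-pred (suc k) B = isCP₀ k B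

  isCP₀-pred-intro : ∀ k {R : Part N₀} → IsColouredPartition n R → m + numBlocks R ≡ k * m + 1 → isCP₀-pred k R ≡ true
  isCP₀-pred-intro zero {R} _ eq = ⊥-elim (m+b≢1 (∈.∈-length (∈-blocks⁺ R fzero)) eq)
    where
    m+b≢1 : ∀ {b} → 0 < b → m + b ≢ 1
    m+b≢1 {suc b} _ eq with trans (sym (+-suc m′ b)) (suc-injective eq)
    ... | ()
  isCP₀-pred-intro (suc k) {R} isColoured eq =
    isColoredPartition-intro n k R isColoured (+-cancelˡ-≡ m _ _ (trans eq (+-assoc m (k * m) 1)))

  extend-block : ∀ k {R} s → isCP₀ k R ≡ true →
    IsColouredPartition (suc n) (extend R (lookup R s)) × isCP₁ k (extend R (lookup R s)) ≡ true
  extend-block k {R} s isCP = extend-coloured , isColoredPartition-intro (suc n) k (extend R (lookup R s)) extend-coloured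
    (trans numBlocks-extend (proj₂ (isColoredPartition-elim n k R isCP)))
    where open JoinBlock (proj₁ (isColoredPartition-elim n k R isCP)) s

  extend-orbit : ∀ k {R} → isCP₀-pred k R ≡ true →
    IsColouredPartition (suc n) (extend R ∅) × isCP₁ k (extend R ∅) ≡ true
  extend-orbit (suc k) {R} isCP = extend-coloured , isColoredPartition-intro (suc n) (suc k) (extend R ∅) extend-coloured
    (trans numBlocks-extend (trans (cong (m +_) (proj₂ (isColoredPartition-elim n k R isCP))) (sym (+-assoc m (k * m) 1))))
    where open NewOrbit (proj₁ (isColoredPartition-elim n k R isCP))

  module _ (k : ℕ) (Φ : Part N₁ → Bool) (Ψ₀ Ψ : Part N₀ → Bool)
           (Φ-zero : ∀ {B} → IsColouredPartition (suc n) B → rel B fzero (new fzero) ≡ true → Φ B ≡ Ψ₀ (restrict B))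
           (Φ-nonzero : ∀ {B} → IsColouredPartition (suc n) B → rel B fzero (new fzero) ≡ false → Φ B ≡ Ψ (restrict B))
           where

    counted : Part N₁ → Bool
    counted B = isCP₁ k B ∧ Φ B

    joinsZero newOrbit joinsBlock admissible : Part N₀ × Subset N₀ → Bool
    joinsZero  (R , S) = (isCP₀ k R ∧ Ψ₀ R) ∧ eqSub S (lookup R fzero)
    newOrbit   (R , S) = (isCP₀-pred k R ∧ Ψ R) ∧ eqSub S ∅
    joinsBlock (R , S) = (isCP₀ k R ∧ Ψ R) ∧ (isBlock R S ∧ not (lookup S fzero))
    admissible z = joinsZero z ∨ (newOrbit z ∨ joinsBlock z)

    joinsZero-elim : ∀ R S → joinsZero (R , S) ≡ true → (isCP₀ k R ≡ true × Ψ₀ R ≡ true) × S ≡ lookup R fzero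
    joinsZero-elim R S z = let isCPψ , S≡ = ∧-elim {isCP₀ k R ∧ Ψ₀ R} z in ∧-elim {isCP₀ k R} isCPψ , eqSub-sound S≡

    joinsZero-intro : ∀ R → isCP₀ k R ≡ true → Ψ₀ R ≡ true → joinsZero (R , lookup R fzero) ≡ true
    joinsZero-intro R isCP ψ = ∧-intro (∧-intro isCP ψ) (eqSub-refl (lookup R fzero))

    newOrbit-elim : ∀ R S → newOrbit (R , S) ≡ true → (isCP₀-pred k R ≡ true × Ψ R ≡ true) × S ≡ ∅
    newOrbit-elim R S o = let isCPψ , S≡ = ∧-elim {isCP₀-pred k R ∧ Ψ R} o in ∧-elim {isCP₀-pred k R} isCPψ , eqSub-sound S≡

    newOrbit-intro : ∀ R → isCP₀-pred k R ≡ true → Ψ R ≡ true → newOrbit (R , ∅) ≡ true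
    newOrbit-intro R isCP ψ = ∧-intro (∧-intro isCP ψ) (eqSub-refl ∅)

    joinsBlock-elim : ∀ R S → joinsBlock (R , S) ≡ true →
      (isCP₀ k R ≡ true × Ψ R ≡ true) × (∃ λ s → S ≡ lookup R s) × lookup S fzero ≡ false
    joinsBlock-elim R S b =
      let isCPψ , isB∧S≁0 = ∧-elim {isCP₀ k R ∧ Ψ R} b ; isB , S≁0 = ∧-elim {isBlock R S} isB∧S≁0 in
      ∧-elim {isCP₀ k R} isCPψ , isBlock-elim R isB , trans (sym (not-involutive _)) (cong not S≁0)

    joinsBlock-intro : ∀ R s → isCP₀ k R ≡ true → Ψ R ≡ true → rel R s fzero ≡ false →
      joinsBlock (R , lookup R s) ≡ true
    joinsBlock-intro R s isCP ψ s≁0 = ∧-intro (∧-intro isCP ψ) (∧-intro (isBlock-intro R s) (cong not s≁0))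

    module Restriction {B : Part N₁} (isCP : isCP₁ k B ≡ true) (φ : Φ B ≡ true) where
      isColoured : IsColouredPartition (suc n) B
      isColoured = proj₁ (isColoredPartition-elim (suc n) k B isCP)
      open IsColouredPartition isColoured using (symmetric-≡)
      open Link isColoured
      R : Part N₀
      R = restrict B
      R-coloured : IsColouredPartition n R
      R-coloured = restrict-coloured isColoured

      numBlocks-link : ∀ {S} → link B ≡ S → numBlocks (extend R S) ≡ k * m + 1
      numBlocks-link refl = trans (cong numBlocks (extend-restrict isColoured)) (proj₂ (isColoredPartition-elim (suc n) k B isCP))

      joinBlock : ∀ s → link B ≡ lookup R s → isCP₀ k R ≡ true
      joinBlock s link≡ = isColoredPartition-intro n k R R-coloured
        (trans (sym (JoinBlock.numBlocks-extend R-coloured s)) (numBlocks-link link≡))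

      atZero : rel B fzero (new fzero) ≡ true → joinsZero (R , link B) ≡ true
      atZero r = subst (λ T → joinsZero (R , T) ≡ true) (sym (link-zero r))
        (joinsZero-intro R (joinBlock fzero (link-zero r)) (trans (sym (Φ-zero isColoured r)) φ))

      inBlock : rel B fzero (new fzero) ≡ false → ∀ y → rel B (new fzero) (old y) ≡ true → joinsBlock (R , link B) ≡ true
      inBlock r y ry = subst (λ T → joinsBlock (R , T) ≡ true) (sym (link-block y ry))
        (joinsBlock-intro R y (joinBlock y (link-block y ry)) (trans (sym (Φ-nonzero isColoured r)) φ)
          (trans (cong (λ T → lookup T fzero) (sym (link-block y ry)))
            (trans (link-lookup B fzero) (trans (symmetric-≡ (new fzero) fzero) r))))

      inOrbit : rel B fzero (new fzero) ≡ false → (∀ y → rel B (new fzero) (old y) ≡ false) → newOrbit (R , link B) ≡ true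
      inOrbit r unlinked = subst (λ T → newOrbit (R , T) ≡ true) (sym (link-empty unlinked))
        (newOrbit-intro R (isCP₀-pred-intro k R-coloured
          (trans (sym (NewOrbit.numBlocks-extend R-coloured)) (numBlocks-link (link-empty unlinked))))
          (trans (sym (Φ-nonzero isColoured r)) φ))

      notAtZero : rel B fzero (new fzero) ≡ false →
        (∃ λ y → rel B (new fzero) (old y) ≡ true) ⊎ (∀ y → rel B (new fzero) (old y) ≡ false) →
        admissible (R , link B) ≡ true
      notAtZero r (inj₁ (y , ry)) = ∨-introʳ (joinsZero (R , link B)) (∨-introʳ (newOrbit (R , link B)) (inBlock r y ry))
      notAtZero r (inj₂ unlinked) = ∨-introʳ (joinsZero (R , link B)) (∨-introˡ (inOrbit r unlinked))

      admissible-restrict : ∀ b → rel B fzero (new fzero) ≡ b → admissible (R , link B) ≡ true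
      admissible-restrict true  r = ∨-introˡ (atZero r)
      admissible-restrict false r = notAtZero r (anyF-cases N₀ (λ y → rel B (new fzero) (old y)))

    restrict-admissible : ∀ B → counted B ≡ true → admissible (restrict B , link B) ≡ true
    restrict-admissible B countedB = let isCP , φ = ∧-elim {isCP₁ k B} countedB in
      Restriction.admissible-restrict isCP φ (rel B fzero (new fzero)) refl

    counted-at : ∀ {R S T} → S ≡ T → counted (extend R T) ≡ true → counted (extend R S) ≡ true
    counted-at refl c = c

    joinsZero-counted : ∀ R S → joinsZero (R , S) ≡ true → counted (extend R S) ≡ true
    joinsZero-counted R S z = let (isCP , ψ) , S≡ = joinsZero-elim R S z ; isColoured , isCP₁ = extend-block k fzero isCP in
      counted-at S≡ (∧-intro isCP₁ (trans (Φ-zero isColoured (trans (rel-extend-old-new R (lookup R fzero) fzero fzero)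
        (IsColouredPartition.reflexive (proj₁ (isColoredPartition-elim n k R isCP)) fzero)))
        (trans (cong Ψ₀ (restrict-extend R _)) ψ)))

    joinsBlock-counted : ∀ R S → joinsBlock (R , S) ≡ true → counted (extend R S) ≡ true
    joinsBlock-counted R S b = let (isCP , ψ) , (s , S≡) , S≁0 = joinsBlock-elim R S b ; isColoured , isCP₁ = extend-block k s isCP in
      counted-at S≡ (∧-intro isCP₁ (trans (Φ-nonzero isColoured (trans (rel-extend-old-new R (lookup R s) fzero fzero)
        (trans (cong (λ T → lookup T fzero) (sym S≡)) S≁0))) (trans (cong Ψ (restrict-extend R _)) ψ)))

    newOrbit-counted : ∀ R S → newOrbit (R , S) ≡ true → counted (extend R S) ≡ true
    newOrbit-counted R S o = let (isCP , ψ) , S≡ = newOrbit-elim R S o ; isColoured , isCP₁ = extend-orbit k isCP in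
      counted-at S≡ (∧-intro isCP₁ (trans (Φ-nonzero isColoured (trans (rel-extend-old-new R ∅ fzero fzero) (∅-lookup fzero)))
        (trans (cong Ψ (restrict-extend R ∅)) ψ)))

    extend-counted : ∀ R S → admissible (R , S) ≡ true → counted (extend R S) ≡ true
    extend-counted R S adm =
      [ joinsZero-counted R S , [ newOrbit-counted R S , joinsBlock-counted R S ]′ ∘ ∨-elim {newOrbit (R , S)} ]′
        (∨-elim {joinsZero (R , S)} adm)

    joinsZero-∋0 : ∀ R S → joinsZero (R , S) ≡ true → lookup S fzero ≡ true
    joinsZero-∋0 R S z = let (isCP , _) , S≡ = joinsZero-elim R S z in
      trans (cong (λ T → lookup T fzero) S≡) (IsColouredPartition.reflexive (proj₁ (isColoredPartition-elim n k R isCP)) fzero)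

    joinsZero-disjoint : ∀ z → joinsZero z ≡ true → newOrbit z ∨ joinsBlock z ≡ true → ⊥
    joinsZero-disjoint (R , S) z other = contradiction (trans (sym (joinsZero-∋0 R S z)) (S∌0 (∨-elim {newOrbit (R , S)} other))) λ ()
      where
      S∌0 : (newOrbit (R , S) ≡ true) ⊎ (joinsBlock (R , S) ≡ true) → lookup S fzero ≡ false
      S∌0 (inj₁ o) = trans (cong (λ T → lookup T fzero) (proj₂ (newOrbit-elim R S o))) (∅-lookup fzero)
      S∌0 (inj₂ b) = proj₂ (proj₂ (joinsBlock-elim R S b))

    newOrbit-disjoint : ∀ z → newOrbit z ≡ true → joinsBlock z ≡ true → ⊥
    newOrbit-disjoint (R , S) o b =
      let S≡∅ = proj₂ (newOrbit-elim R S o) ; (isCP , _) , (s , S≡) , _ = joinsBlock-elim R S b in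
      contradiction (trans (sym (∅-lookup s)) (trans (cong (λ T → lookup T s) (trans (sym S≡∅) S≡))
        (IsColouredPartition.reflexive (proj₁ (isColoredPartition-elim n k R isCP)) s))) λ ()

    Pairs : List (Part N₀ × Subset N₀)
    Pairs = cartesianProduct (allParts N₀) (allSubsets N₀)

    count-counted : count counted (allParts N₁) ≡ count admissible Pairs
    count-counted = count-bijection (allParts-unique N₁) (Unique.cartesianProduct⁺ (allParts-unique N₀) (allSubsets-unique N₀))
      ∈-allParts (λ (R , S) → ∈.∈-cartesianProduct⁺ (∈-allParts R) (∈-allSubsets S))
      counted admissible (λ B → restrict B , link B) (λ (R , S) → extend R S)
      restrict-admissible
      (λ B countedB → extend-restrict (proj₁ (isColoredPartition-elim (suc n) k B (proj₁ (∧-elim {isCP₁ k B} countedB)))))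
      (λ (R , S) → extend-counted R S)
      (λ (R , S) _ → cong₂ _,_ (restrict-extend R S) (link-extend R S))

    count-joinsZero : count joinsZero Pairs ≡ count (λ R → isCP₀ k R ∧ Ψ₀ R) (allParts N₀)
    count-joinsZero = trans
      (count-cartesianProduct (λ R → isCP₀ k R ∧ Ψ₀ R) (λ R S → eqSub S (lookup R fzero)) 1 (allParts N₀) (allSubsets N₀)
        (λ R _ → count-eqSub (lookup R fzero)))
      (*-identityˡ (count (λ R → isCP₀ k R ∧ Ψ₀ R) (allParts N₀)))

    count-newOrbit : count newOrbit Pairs ≡ count (λ R → isCP₀-pred k R ∧ Ψ R) (allParts N₀)
    count-newOrbit = trans
      (count-cartesianProduct (λ R → isCP₀-pred k R ∧ Ψ R) (λ R S → eqSub S (∅ {N₀})) 1 (allParts N₀) (allSubsets N₀)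
        (λ R _ → count-eqSub (∅ {N₀})))
      (*-identityˡ (count (λ R → isCP₀-pred k R ∧ Ψ R) (allParts N₀)))

    count-joinsBlock : count joinsBlock Pairs ≡ k * m * count (λ R → isCP₀ k R ∧ Ψ R) (allParts N₀)
    count-joinsBlock = count-cartesianProduct (λ R → isCP₀ k R ∧ Ψ R) (λ R S → isBlock R S ∧ not (lookup S fzero)) (k * m)
      (allParts N₀) (allSubsets N₀) (λ R isCPψ → count-nonzeroBlocks {n} {k} {R} (proj₁ (∧-elim {isCP₀ k R} isCPψ)))

    recurrence : count counted (allParts N₁) ≡
      count (λ R → isCP₀ k R ∧ Ψ₀ R) (allParts N₀) +
      (count (λ R → isCP₀-pred k R ∧ Ψ R) (allParts N₀) + k * m * count (λ R → isCP₀ k R ∧ Ψ R) (allParts N₀))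
    recurrence = begin
      count counted (allParts N₁)                                        ≡⟨ count-counted ⟩
      count admissible Pairs                                             ≡⟨ count-∨ joinsZero _ Pairs joinsZero-disjoint ⟩
      count joinsZero Pairs + count (λ z → newOrbit z ∨ joinsBlock z) Pairs
        ≡⟨ cong (count joinsZero Pairs +_) (count-∨ newOrbit joinsBlock Pairs newOrbit-disjoint) ⟩
      count joinsZero Pairs + (count newOrbit Pairs + count joinsBlock Pairs)
        ≡⟨ cong₂ _+_ count-joinsZero (cong₂ _+_ count-newOrbit count-joinsBlock) ⟩
      count (λ R → isCP₀ k R ∧ Ψ₀ R) (allParts N₀) +
      (count (λ R → isCP₀-pred k R ∧ Ψ R) (allParts N₀) + k * m * count (λ R → isCP₀ k R ∧ Ψ R) (allParts N₀)) ∎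
      where open ≡-Reasoning

-- The three counts

anyF-cong : ∀ {N} {p q : Fin N → Bool} → (∀ x → p x ≡ q x) → anyF N p ≡ anyF N q
anyF-cong {N} p≗q = cong or (List.map-cong p≗q (allFin N))

anyF-false : ∀ N (p : Fin N → Bool) → (∀ x → p x ≡ false) → anyF N p ≡ false
anyF-false N p p≗false = ≢true⇒≡false (λ any≡t → let x , px = anyF-elim N p any≡t in
  contradiction (trans (sym px) (p≗false x)) λ ())

allF-false : ∀ N (p : Fin N → Bool) x → p x ≡ false → allF N p ≡ false
allF-false N p x px = ≢true⇒≡false (λ all≡t → contradiction (trans (sym (allF-elim N p all≡t x)) px) λ ())

eqFin-injective : ∀ {A B} {f : Fin A → Fin B} → (∀ {x y} → f x ≡ f y → x ≡ y) →
  ∀ x y → eqFin (f x) (f y) ≡ eqFin x y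
eqFin-injective {f = f} f-inj x y = Bool-ext
  (λ eq → subst (λ t → eqFin x t ≡ true) (f-inj (eqFin-sound eq)) (eqFin-refl x))
  (λ eq → subst (λ t → eqFin (f x) (f t) ≡ true) (eqFin-sound eq) (eqFin-refl (f x)))

module Statistics (m′ : ℕ) where
  open Colours m′
  open Coloured m′

  trivialPoint : ∀ n → Part (suc (n * m)) → Fin (suc (n * m)) → Bool
  trivialPoint n B y = eqFin y fzero ∨ not (rel B fzero y)

  trivialZeroBlock : ∀ n → Part (suc (n * m)) → Bool
  trivialZeroBlock n B = allF (suc (n * m)) (trivialPoint n B)

  inSpecialZeroBlock : ∀ n → Fin n → Fin (suc (n * m)) → Bool
  inSpecialZeroBlock n i y = eqFin y fzero ∨ anyF m (λ d → eqFin y (col n m i d))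

  isSpecialZero-elim : ∀ n B → isSpecialZero n m B ≡ true → ∃ λ i → ∀ y → rel B fzero y ≡ inSpecialZeroBlock n i y
  isSpecialZero-elim n B special = let i , zero≡ = anyF-elim n _ special in
    i , (λ y → trans (cong (λ V → lookup V y) (eqSub-sound zero≡)) (Vec.lookup∘tabulate (inSpecialZeroBlock n i) y))

  isSpecialZero-intro : ∀ n B i → (∀ y → rel B fzero y ≡ inSpecialZeroBlock n i y) → isSpecialZero n m B ≡ true
  isSpecialZero-intro n B i zero≗ = anyF-intro n _ i (subst (λ V → eqSub (lookup B fzero) V ≡ true)
    (Vec-ext (λ y → trans (zero≗ y) (sym (Vec.lookup∘tabulate (inSpecialZeroBlock n i) y)))) (eqSub-refl _))

  trivialZeroBlock-elim : ∀ n {B} → IsColouredPartition n B → trivialZeroBlock n B ≡ true →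
    ∀ y → rel B fzero y ≡ eqFin y fzero
  trivialZeroBlock-elim n {B} isColoured triv y = Bool-ext
    (λ y∼0 → trans (sym (∨-identityʳ (eqFin y fzero)))
      (subst (λ t → eqFin y fzero ∨ not t ≡ true) y∼0 (allF-elim _ (trivialPoint n B) triv y)))
    (λ y≡0 → subst (λ t → rel B fzero t ≡ true) (sym (eqFin-sound y≡0)) (IsColouredPartition.reflexive isColoured fzero))

  module Transport (n : ℕ) where
    open Extension m′ n

    eqFin-old-old : ∀ x y → eqFin (old x) (old y) ≡ eqFin x y
    eqFin-old-old = eqFin-injective old-injective

    eqFin-new-old : ∀ c x → eqFin (new c) (old x) ≡ false
    eqFin-new-old c x = eqFin-≢ (λ eq → old≢new x c (sym eq))

    inSpecial-old : ∀ i y → inSpecialZeroBlock (suc n) (fsuc i) (old y) ≡ inSpecialZeroBlock n i y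
    inSpecial-old i y = cong₂ _∨_ (eqFin-old-old y fzero) (anyF-cong (λ d → eqFin-old-old y (col n m i d)))

    inSpecial-new : ∀ i c → inSpecialZeroBlock (suc n) (fsuc i) (new c) ≡ false
    inSpecial-new i c = cong₂ _∨_ (eqFin-new-old c fzero) (anyF-false m _ (λ d → eqFin-new-old c (col n m i d)))

    inSpecial₀-old : ∀ y → inSpecialZeroBlock (suc n) fzero (old y) ≡ eqFin y fzero
    inSpecial₀-old y = trans (cong₂ _∨_ (eqFin-old-old y fzero) (anyF-false m _ (λ d → eqFin-≢ (old≢new y d))))
                           (∨-identityʳ _)

    inSpecial₀-new : ∀ c → inSpecialZeroBlock (suc n) fzero (new c) ≡ true
    inSpecial₀-new c = ∨-introʳ (eqFin (new c) fzero) (anyF-intro m _ c (eqFin-refl (new c)))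

    trivialPoint-old : ∀ B y → trivialPoint (suc n) B (old y) ≡ trivialPoint n (restrict B) y
    trivialPoint-old B y = cong₂ _∨_ (eqFin-old-old y fzero) (cong not (sym (rel-restrict B fzero y)))

    module _ {B : Part N₁} (isColoured : IsColouredPartition (suc n) B) where
      open IsColouredPartition isColoured
      open NewPoints isColoured using (rel-zero-new)

      trivial-zero : rel B fzero (new fzero) ≡ true → trivialZeroBlock (suc n) B ≡ false
      trivial-zero r = allF-false N₁ (trivialPoint (suc n) B) (new fzero) (cong₂ _∨_ (eqFin-new-old fzero fzero) (cong not r))

      trivial-nonzero : rel B fzero (new fzero) ≡ false → trivialZeroBlock (suc n) B ≡ trivialZeroBlock n (restrict B)
      trivial-nonzero r = Bool-ext
        (λ triv → allF-intro N₀ (trivialPoint n (restrict B)) (λ y →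
          trans (sym (trivialPoint-old B y)) (allF-elim N₁ (trivialPoint (suc n) B) triv (old y))))
        (λ triv → allF-intro N₁ (trivialPoint (suc n) B) (point triv))
        where
        point : trivialZeroBlock n (restrict B) ≡ true → ∀ y → trivialPoint (suc n) B y ≡ true
        point triv y with classified y
        ... | isOld y = trans (trivialPoint-old B y) (allF-elim N₀ (trivialPoint n (restrict B)) triv y)
        ... | isNew c = ∨-introʳ (eqFin (new c) fzero) (cong not (trans (rel-zero-new c) r))

      special-zero : rel B fzero (new fzero) ≡ true → isSpecialZero (suc n) m B ≡ trivialZeroBlock n (restrict B)
      special-zero r = Bool-ext to from
        where
        to : isSpecialZero (suc n) m B ≡ true → trivialZeroBlock n (restrict B) ≡ true
        to special with isSpecialZero-elim (suc n) B special
        ... | fsuc i , zero≗ = contradiction (trans (sym r) (trans (zero≗ (new fzero)) (inSpecial-new i fzero))) λ ()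
        ... | fzero  , zero≗ = allF-intro N₀ (trivialPoint n (restrict B)) (λ y → trans
          (cong (λ t → eqFin y fzero ∨ not t) (trans (rel-restrict B fzero y) (trans (zero≗ (old y)) (inSpecial₀-old y))))
          (∨-inverseʳ (eqFin y fzero)))
        from : trivialZeroBlock n (restrict B) ≡ true → isSpecialZero (suc n) m B ≡ true
        from triv = isSpecialZero-intro (suc n) B fzero point
          where
          point : ∀ y → rel B fzero y ≡ inSpecialZeroBlock (suc n) fzero y
          point y with classified y
          ... | isNew c = trans (rel-zero-new c) (trans r (sym (inSpecial₀-new c)))
          ... | isOld y = trans (sym (rel-restrict B fzero y))
            (trans (trivialZeroBlock-elim n (restrict-coloured isColoured) triv y) (sym (inSpecial₀-old y)))

      special-nonzero : rel B fzero (new fzero) ≡ false → isSpecialZero (suc n) m B ≡ isSpecialZero n m (restrict B)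
      special-nonzero r = Bool-ext to from
        where
        to : isSpecialZero (suc n) m B ≡ true → isSpecialZero n m (restrict B) ≡ true
        to special with isSpecialZero-elim (suc n) B special
        ... | fzero  , zero≗ = contradiction (trans (sym (trans (zero≗ (new fzero)) (inSpecial₀-new fzero))) r) λ ()
        ... | fsuc i , zero≗ = isSpecialZero-intro n (restrict B) i
          (λ y → trans (rel-restrict B fzero y) (trans (zero≗ (old y)) (inSpecial-old i y)))
        from : isSpecialZero n m (restrict B) ≡ true → isSpecialZero (suc n) m B ≡ true
        from special with isSpecialZero-elim n (restrict B) special
        ... | i , zero≗ = isSpecialZero-intro (suc n) B (fsuc i) point
          where
          point : ∀ y → rel B fzero y ≡ inSpecialZeroBlock (suc n) (fsuc i) y
          point y with classified y
          ... | isNew c = trans (rel-zero-new c) (trans r (sym (inSpecial-new i c)))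
          ... | isOld y = trans (sym (rel-restrict B fzero y)) (trans (zero≗ y) (sym (inSpecial-old i y)))

module Formulas (m′ : ℕ) where
  open Colours m′
  open Coloured m′
  open Statistics m′

  countWith : ∀ n k → (Part (suc (n * m)) → Bool) → ℕ
  countWith n k Φ = count (λ B → isColoredPartition m n k B ∧ Φ B) (allParts (suc (n * m)))

  countWith-false : ∀ n k → countWith n k (λ _ → false) ≡ 0
  countWith-false n k = trans (count-cong (λ B → ∧-zeroʳ (isColoredPartition m n k B)) (allParts (suc (n * m))))
                              (count-false (allParts (suc (n * m))))

  countWith-0-0 : ∀ Φ → countWith 0 0 Φ ≡ (if Φ ((true ∷ []) ∷ []) then 1 else 0)
  countWith-0-0 Φ with Φ ((true ∷ []) ∷ [])
  ... | true  = refl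
  ... | false = refl

  countWith-0-suc : ∀ k Φ → countWith 0 (suc k) Φ ≡ 0
  countWith-0-suc k Φ rewrite +-comm (m′ + k * m) 1 = refl

  countWith⁻ : ∀ (n k : ℕ) → (Part (suc (n * m)) → Bool) → ℕ
  countWith⁻ n zero    Φ = 0
  countWith⁻ n (suc k) Φ = countWith n k Φ

  module Steps (n : ℕ) where
    open Extension m′ n
    open Recurrence m′ n
    open Transport n

    countWith-suc : ∀ k (Φ : Part N₁ → Bool) (Ψ₀ Ψ : Part N₀ → Bool) →
      (∀ {B} → IsColouredPartition (suc n) B → rel B fzero (new fzero) ≡ true → Φ B ≡ Ψ₀ (restrict B)) →
      (∀ {B} → IsColouredPartition (suc n) B → rel B fzero (new fzero) ≡ false → Φ B ≡ Ψ (restrict B)) →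
      countWith (suc n) k Φ ≡ countWith n k Ψ₀ + (countWith⁻ n k Ψ + k * m * countWith n k Ψ)
    countWith-suc zero    Φ Ψ₀ Ψ Φ-zero Φ-nonzero = trans (recurrence 0 Φ Ψ₀ Ψ Φ-zero Φ-nonzero)
      (cong (λ c → countWith n 0 Ψ₀ + (c + 0)) (count-false (allParts N₀)))
    countWith-suc (suc k) Φ Ψ₀ Ψ Φ-zero Φ-nonzero = recurrence (suc k) Φ Ψ₀ Ψ Φ-zero Φ-nonzero

    countWith-true-suc : ∀ k → countWith (suc n) k (λ _ → true) ≡
      countWith n k (λ _ → true) + (countWith⁻ n k (λ _ → true) + k * m * countWith n k (λ _ → true))
    countWith-true-suc k = countWith-suc k _ _ _ (λ _ _ → refl) (λ _ _ → refl)

    countWith-trivial-suc : ∀ k → countWith (suc n) k (trivialZeroBlock (suc n)) ≡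
      countWith n k (λ _ → false) + (countWith⁻ n k (trivialZeroBlock n) + k * m * countWith n k (trivialZeroBlock n))
    countWith-trivial-suc k = countWith-suc k _ _ _ trivial-zero trivial-nonzero

    countWith-special-suc : ∀ k → countWith (suc n) k (isSpecialZero (suc n) m) ≡
      countWith n k (trivialZeroBlock n) + (countWith⁻ n k (isSpecialZero n m) + k * m * countWith n k (isSpecialZero n m))
    countWith-special-suc k = countWith-suc k _ _ _ special-zero special-nonzero

  hsub-vars1 : ∀ a b k → hsub a b (vars1 m (suc k)) ≡ hsub a b (vars1 m k) + (suc k * m + 1) * hsub a (suc b) (vars1 m (suc k))
  hsub-vars1 a b k rewrite vars1-∷ʳ m k = hsub-∷ʳ a b (vars1 m k) (suc k * m + 1)

  hsub-vars2 : ∀ a b k → hsub a b (vars2 m (suc k)) ≡ hsub a b (vars2 m k) + suc k * m * hsub a (suc b) (vars2 m (suc k))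
  hsub-vars2 a b k rewrite vars2-∷ʳ m k = hsub-∷ʳ a b (vars2 m k) (suc k * m)

  countWith-true≡hsub : ∀ n k → countWith n k (λ _ → true) ≡ hsub n k (vars1 m k)
  countWith-true≡hsub zero    zero    = countWith-0-0 (λ _ → true)
  countWith-true≡hsub zero    (suc k) = countWith-0-suc k (λ _ → true)
  countWith-true≡hsub (suc n) zero    = begin
    countWith (suc n) 0 (λ _ → true)                  ≡⟨ Steps.countWith-true-suc n 0 ⟩
    countWith n 0 (λ _ → true) + 0                    ≡⟨ +-identityʳ _ ⟩
    countWith n 0 (λ _ → true)                        ≡⟨ countWith-true≡hsub n 0 ⟩
    hsub n 0 (1 ∷ [])                                 ≡⟨ *-identityˡ _ ⟨
    1 * hsub (suc n) 1 (1 ∷ [])                       ≡⟨ hsub-∷ʳ (suc n) 0 [] 1 ⟨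
    hsub (suc n) 0 (1 ∷ [])                           ∎
    where open ≡-Reasoning
  countWith-true≡hsub (suc n) (suc k) = begin
    countWith (suc n) (suc k) (λ _ → true)            ≡⟨ Steps.countWith-true-suc n (suc k) ⟩
    X + (Y + c * X)
      ≡⟨ cong₂ (λ a b → a + (b + c * a)) (countWith-true≡hsub n (suc k)) (countWith-true≡hsub n k) ⟩
    X′ + (Y′ + c * X′)
      ≡⟨ solve 3 (λ a b c → a :+ (b :+ c :* a) := b :+ (c :+ con 1) :* a) refl X′ Y′ c ⟩
    Y′ + (c + 1) * X′                                 ≡⟨ hsub-vars1 n k k ⟨
    hsub (suc n) (suc k) (vars1 m (suc k))            ∎
    where
    open ≡-Reasoning
    open +-*-Solver
    c X Y X′ Y′ : ℕ
    c = suc k * m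
    X = countWith n (suc k) (λ _ → true)
    Y = countWith n k (λ _ → true)
    X′ = hsub n (suc k) (vars1 m (suc k))
    Y′ = hsub n k (vars1 m k)

  countWith-trivial≡hsub : ∀ n k → countWith n k (trivialZeroBlock n) ≡ hsub n k (vars2 m k)
  countWith-trivial≡hsub zero    zero    = countWith-0-0 (trivialZeroBlock 0)
  countWith-trivial≡hsub zero    (suc k) = countWith-0-suc k (trivialZeroBlock 0)
  countWith-trivial≡hsub (suc n) zero    = trans (Steps.countWith-trivial-suc n 0) (cong (_+ 0) (countWith-false n 0))
  countWith-trivial≡hsub (suc n) (suc k) = begin
    countWith (suc n) (suc k) (trivialZeroBlock (suc n))         ≡⟨ Steps.countWith-trivial-suc n (suc k) ⟩
    countWith n (suc k) (λ _ → false) + (countWith n k (trivialZeroBlock n) + c * countWith n (suc k) (trivialZeroBlock n))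
      ≡⟨ cong₂ _+_ (countWith-false n (suc k))
           (cong₂ (λ a b → a + c * b) (countWith-trivial≡hsub n k) (countWith-trivial≡hsub n (suc k))) ⟩
    0 + (hsub n k (vars2 m k) + c * hsub n (suc k) (vars2 m (suc k))) ≡⟨ hsub-vars2 n k k ⟨
    hsub n k (vars2 m (suc k))                                  ∎
    where
    open ≡-Reasoning
    c : ℕ
    c = suc k * m

  n*h[]≡0 : ∀ n → n * h n [] ≡ 0
  n*h[]≡0 zero    = refl
  n*h[]≡0 (suc n) = *-zeroʳ (suc n)

  countWith-special≡hsub : ∀ n k → countWith n k (isSpecialZero n m) ≡ n * hsub n (suc k) (vars2 m k)
  countWith-special≡hsub zero    k       = countWith-false 0 k
  countWith-special≡hsub (suc n) zero    = begin
    countWith (suc n) 0 (isSpecialZero (suc n) m)      ≡⟨ Steps.countWith-special-suc n 0 ⟩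
    countWith n 0 (trivialZeroBlock n) + 0              ≡⟨ cong (_+ 0) (countWith-trivial≡hsub n 0) ⟩
    h n [] + 0                                          ≡⟨ cong (h n [] +_) (n*h[]≡0 n) ⟨
    h n [] + n * h n []                                 ∎
    where open ≡-Reasoning
  countWith-special≡hsub (suc n) (suc k) = begin
    countWith (suc n) (suc k) (isSpecialZero (suc n) m)  ≡⟨ Steps.countWith-special-suc n (suc k) ⟩
    countWith n (suc k) (trivialZeroBlock n) + (countWith n k (isSpecialZero n m) + c * countWith n (suc k) (isSpecialZero n m))
      ≡⟨ cong₂ _+_ (countWith-trivial≡hsub n (suc k))
           (cong₂ (λ a b → a + c * b) (countWith-special≡hsub n k) (countWith-special≡hsub n (suc k))) ⟩
    H + (n * X + c * (n * Y))
      ≡⟨ cong (H +_) (solve 4 (λ n x c y → n :* x :+ c :* (n :* y) := n :* (x :+ c :* y)) refl n X c Y) ⟩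
    H + n * (X + c * Y)                                  ≡⟨ cong (λ t → H + n * t) (hsub-vars2 n (suc k) k) ⟨
    H + n * H                                            ∎
    where
    open ≡-Reasoning
    open +-*-Solver
    c H X Y : ℕ
    c = suc k * m
    H = hsub n (suc k) (vars2 m (suc k))
    X = hsub n (suc k) (vars2 m k)
    Y = hsub n (suc (suc k)) (vars2 m (suc k))

open import Data.Integer using (+_; _-_)
open import Data.Integer.Properties using ([+m]-[+n]≡m⊖n; ⊖-≥)

+[a+b]-+b : ∀ a b → + (a + b) - + b ≡ + a
+[a+b]-+b a b = trans ([+m]-[+n]≡m⊖n (a + b) b) (trans (⊖-≥ (m≤n+m b a)) (cong +_ (m+n∸n≡m a b)))

theorem2p5 : (m n k : ℕ) → .{{_ : NonZero m}} →
    (Scol m n k ≡ hsub n k (vars1 m k))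
    × (+ Sbar m n k ≡ + hsub n k (vars1 m k) - + (n * hsub n (suc k) (vars2 m k)))
theorem2p5 (suc m′) n k = Scol≡ , Sbar≡
  where
  open Colours m′ using (m)
  open Formulas m′
  Parts : List (Part (suc (n * m)))
  Parts = allParts (suc (n * m))
  special : ℕ
  special = countWith n k (isSpecialZero n m)
  Scol≡ : Scol m n k ≡ hsub n k (vars1 m k)
  Scol≡ = trans (count-cong (λ B → sym (∧-identityʳ (isColoredPartition m n k B))) Parts) (countWith-true≡hsub n k)
  Scol≡Sbar+special : Scol m n k ≡ Sbar m n k + special
  Scol≡Sbar+special = count-split (isColoredPartition m n k) (isSpecialZero n m) Parts
  Sbar≡ : + Sbar m n k ≡ + hsub n k (vars1 m k) - + (n * hsub n (suc k) (vars2 m k))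
  Sbar≡ = begin
    + Sbar m n k                          ≡⟨ +[a+b]-+b (Sbar m n k) special ⟨
    + (Sbar m n k + special) - + special  ≡⟨ cong₂ (λ a b → + a - + b) (trans (sym Scol≡Sbar+special) Scol≡)
                                                                       (countWith-special≡hsub n k) ⟩
    + hsub n k (vars1 m k) - + (n * hsub n (suc k) (vars2 m k)) ∎
    where open ≡-Reasoning
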